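{- Let $B\in\mathrm{M}_3(\mathbb{R})$ be a cluster-cyclic skew-symmetrizable matrix and $\mathbf w\in\mathcal T\setminus\{\emptyset\}$. (a) $\mathbf w$ is in a trunk $\iff$ $\varepsilon_T^{\mathbf w}\ne\varepsilon_K^{\mathbf w}$ $\iff$ $\varepsilon_T^{\mathbf w}\mathrm{sign}(b_{KT}^{\mathbf w})=1$; and $\mathbf w$ is in a branch $\iff$ $\varepsilon_T^{\mathbf w}=\varepsilon_K^{\mathbf w}$ $\iff$ $\varepsilon_T^{\mathbf w}\mathrm{sign}(b_{KT}^{\mathbf w})=-1$. (In both cases $\varepsilon_K^{\mathbf w}\ne\varepsilon_S^{\mathbf w}$.) (b) $(K(\mathbf wS),S(\mathbf wS),T(\mathbf wS))=(S(\mathbf w),K(\mathbf w),T(\mathbf w))$, and $(K(\mathbf wT),S(\mathbf wT),T(\mathbf wT))$ equals $(T(\mathbf w),S(\mathbf w),K(\mathbf w))$ if $\mathbf w$ is in a trunk and $(T(\mathbf w),K(\mathbf w),S(\mathbf w))$ if $\mathbf w$ is in a branch.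
   Context: A matrix $B=(b_{ij})\in\mathrm{M}_3(\mathbb{R})$ is skew-symmetrizable if $DB$ is skew-symmetric for some positive diagonal $D$. Notation: $[a]_+=\max(a,0)$, entrywise; $J_k$ diagonal with $k$th entry $-1$, others $1$; $A^{\bullet k}$ (resp. $A^{k\bullet}$) keeps only the $k$th column (resp. row) of $A$. Mutation: $\mu_k(B)=(J_k+[-B]_+^{\bullet k})B(J_k+[B]_+^{k\bullet})$. $\mathcal T$: reduced sequences $\mathbf w=[k_1,\dots,k_r]$ ($k_i\in\{1,2,3\}$, $k_i\ne k_{i+1}$), including $\emptyset$; $\mathbf w[k]$ appends $k$ if $\mathbf w=\emptyset$ or $k\ne k_r$, deletes the last entry if $k=k_r$. $B^{\mathbf w}=\mu_{k_r}\cdots\mu_{k_1}(B)=(b^{\mathbf w}_{ij})$. $C^\emptyset=I$, $C^{\mathbf w[k]}=C^{\mathbf w}J_k+C^{\mathbf w}[B^{\mathbf w}]_+^{k\bullet}+[-C^{\mathbf w}]_+^{\bullet k}B^{\mathbf w}$, columns $\mathbf c_i^{\mathbf w}$. $B$ is cyclic if $\mathrm{sign}(B)=\pm\begin{pmatrix}0&-1&1\\1&0&-1\\-1&1&0\end{pmatrix}$ entrywise; cluster-cyclic if all $B^{\mathbf w}$ are cyclic. For cluster-cyclic $B$ all $\mathbf c_i^{\mathbf w}$ are nonzero and componentwise $\ge0$ or $\le0$, with tropical signs $\varepsilon_i^{\mathbf w}\in\{\pm1\}$, $\varepsilon_i^{\mathbf w}\mathbf c_i^{\mathbf w}\ge\mathbf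 0$. For $\mathbf w\ne\emptyset$ with last index $k$, there is a unique $s\in\{1,2,3\}\setminus\{k\}$ with $\varepsilon_s^{\mathbf w}\mathrm{sign}(b^{\mathbf w}_{ks})=-1$ and $\varepsilon_k^{\mathbf w}\ne\varepsilon_s^{\mathbf w}$; let $t$ be the third index. Define $K(\mathbf w)=k$, $S(\mathbf w)=s$, $T(\mathbf w)=t$, and write $\varepsilon^{\mathbf w}_M=\varepsilon^{\mathbf w}_{M(\mathbf w)}$, $b^{\mathbf w}_{MM'}=b^{\mathbf w}_{M(\mathbf w)M'(\mathbf w)}$ for $M,M'\in\{K,S,T\}$. Let $\mathcal M$ be the free monoid on letters $S,T$, acting on the right on $\mathcal T\setminus\{\emptyset\}$ by $\mathbf wS=\mathbf w[S(\mathbf w)]$, $\mathbf wT=\mathbf w[T(\mathbf w)]$; every $\mathbf w\ne\emptyset$ is uniquely $[i]X$ with $i\in\{1,2,3\}$, $X\in\mathcal M$. $\mathbf w$ is in a trunk if $X=S^n$ for some $n\ge0$, and in a branch if the letter $T$ occurs in $X$. -}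

module Defs where

open import Data.Bool using (Bool; true; false; if_then_else_; _∧_)
open import Data.Fin using (Fin; zero; suc)
open import Data.List using (List; []; _∷_; foldl; replicate)
open import Data.List.Membership.Propositional using (_∈_)
open import Data.Nat using (ℕ)
open import Data.Product using (Σ; ∃; _×_; _,_)
open import Data.Empty using (⊥)
open import Data.Sum using (_⊎_)
open import Relation.Nullary using (¬_; Dec; yes; no)
open import Relation.Binary.Core using (Rel)
open import Relation.Binary.Definitions using (Decidable)
open import Relation.Binary.Structures using (IsTotalOrder)
open import Relation.Binary.PropositionalEquality using (_≡_)
open import Algebra.Structures using (IsCommutativeRing)

-- The real numbers, axiomatised as a complete ordered field
-- (any model is isomorphic to ℝ; the statement quantifies over models).

record RealNumbers : Set₁ where
  infixl 6 _+_
  infixl 7 _*_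
  infix 4 _≤_
  field
    ℝ      : Set
    _+_    : ℝ → ℝ → ℝ
    _*_    : ℝ → ℝ → ℝ
    -_     : ℝ → ℝ
    0ℝ     : ℝ
    1ℝ     : ℝ
    _≤_    : ℝ → ℝ → Set
    isCommutativeRing : IsCommutativeRing _≡_ _+_ _*_ -_ 0ℝ 1ℝ
    0≢1    : ¬ (0ℝ ≡ 1ℝ)
    inverse : ∀ x → ¬ (x ≡ 0ℝ) → ∃ λ y → x * y ≡ 1ℝ
    isTotalOrder : IsTotalOrder _≡_ _≤_
    _≤?_   : Decidable _≤_
    +-mono-≤ : ∀ {x y} z → x ≤ y → x + z ≤ y + z
    *-nonneg : ∀ {x y} → 0ℝ ≤ x → 0ℝ ≤ y → 0ℝ ≤ x * y
    complete : (P : ℝ → Set) → ∃ P → (∃ λ u → ∀ x → P x → x ≤ u) →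
               ∃ λ s → (∀ x → P x → x ≤ s) ×
                       (∀ u → (∀ x → P x → x ≤ u) → s ≤ u)

  _<_ : ℝ → ℝ → Set
  x < y = (x ≤ y) × ¬ (x ≡ y)

data Sign3 : Set where
  neg zer pos : Sign3

data PM : Set where
  plus minus : PM

_·_ : PM → Sign3 → Sign3
plus  · s   = s
minus · neg = pos
minus · zer = zer
minus · pos = neg

negate3 : Sign3 → Sign3
negate3 s = minus · s

eqPM : PM → PM → Bool
eqPM plus plus = true
eqPM minus minus = true
eqPM _ _ = false

eq3 : Sign3 → Sign3 → Bool
eq3 neg neg = true
eq3 zer zer = true
eq3 pos pos = true
eq3 _ _ = false

-- Indices 1,2,3 are represented by Fin 3 (zero ↦ 1, etc.)

I3 : Set
I3 = Fin 3

eqF : ∀ {n} → Fin n → Fin n → Bool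
eqF zero zero = true
eqF (suc i) (suc j) = eqF i j
eqF _ _ = false

third : I3 → I3 → I3
third zero (suc zero) = suc (suc zero)
third (suc zero) zero = suc (suc zero)
third zero (suc (suc zero)) = suc zero
third (suc (suc zero)) zero = suc zero
third _ _ = zero

other₁ other₂ : I3 → I3
other₁ zero = suc zero
other₁ _    = zero
other₂ (suc (suc zero)) = suc zero
other₂ _ = suc (suc zero)

cyclicPattern : I3 → I3 → Sign3
cyclicPattern zero (suc zero) = neg
cyclicPattern zero (suc (suc zero)) = pos
cyclicPattern (suc zero) zero = pos
cyclicPattern (suc zero) (suc (suc zero)) = neg
cyclicPattern (suc (suc zero)) zero = neg
cyclicPattern (suc (suc zero)) (suc zero) = pos
cyclicPattern _ _ = zer

Seq : Set
Seq = List I3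

data Reduced : Seq → Set where
  r[]  : Reduced []
  r[_] : ∀ k → Reduced (k ∷ [])
  r∷   : ∀ {k l ks} → ¬ (k ≡ l) → Reduced (l ∷ ks) → Reduced (k ∷ l ∷ ks)

extend : Seq → I3 → Seq
extend [] k = k ∷ []
extend (x ∷ []) k = if eqF x k then [] else x ∷ k ∷ []
extend (x ∷ y ∷ ys) k = x ∷ extend (y ∷ ys) k

-- last entry (default value on the empty sequence, never used there)
lastE : Seq → I3
lastE [] = zero
lastE (x ∷ []) = x
lastE (x ∷ y ∷ ys) = lastE (y ∷ ys)

data Letter : Set where
  S T : Letter

module Cluster (R : RealNumbers) where
  open RealNumbers R

  Mat : Set
  Mat = I3 → I3 → ℝ

  sign : ℝ → Sign3
  sign x with x ≤? 0ℝ | 0ℝ ≤? x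
  ... | yes _ | yes _ = zer
  ... | yes _ | no  _ = neg
  ... | no  _ | _     = pos

  pos⁺ : ℝ → ℝ
  pos⁺ a with 0ℝ ≤? a
  ... | yes _ = a
  ... | no  _ = 0ℝ

  _⊕_ : Mat → Mat → Mat
  (A ⊕ B) i j = A i j + B i j

  _⊗_ : Mat → Mat → Mat
  (A ⊗ B) i j = A i zero * B zero j
              + A i (suc zero) * B (suc zero) j
              + A i (suc (suc zero)) * B (suc (suc zero)) j

  negM : Mat → Mat
  negM A i j = - (A i j)

  posM : Mat → Mat
  posM A i j = pos⁺ (A i j)

  Id : Mat
  Id i j = if eqF i j then 1ℝ else 0ℝ

  J : I3 → Mat
  J k i j = if eqF i j then (if eqF i k then - 1ℝ else 1ℝ) else 0ℝ

  col : I3 → Mat → Mat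
  col k A i j = if eqF j k then A i j else 0ℝ

  row : I3 → Mat → Mat
  row k A i j = if eqF i k then A i j else 0ℝ

  μ : I3 → Mat → Mat
  μ k B = ((J k ⊕ col k (posM (negM B))) ⊗ B) ⊗ (J k ⊕ row k (posM B))

  Bw : Mat → Seq → Mat
  Bw B w = foldl (λ M k → μ k M) B w

  -- one step  (B^w, C^w) ↦ (B^{w[k]}, C^{w[k]}) for k ≠ last entry
  stepBC : Mat × Mat → I3 → Mat × Mat
  stepBC (M , C) k =
    ( μ k M
    , ((C ⊗ J k) ⊕ (C ⊗ row k (posM M))) ⊕ (col k (posM (negM C)) ⊗ M))

  Cw : Mat → Seq → Mat
  Cw B w = Data.Product.proj₂ (foldl stepBC (B , Id) w)

  SkewSymmetrizable : Mat → Set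
  SkewSymmetrizable B =
    Σ (I3 → ℝ) λ D → (∀ i → 0ℝ < D i) ×
                     (∀ i j → D i * B i j ≡ - (D j * B j i))

  Cyclic : Mat → Set
  Cyclic B = (∀ i j → sign (B i j) ≡ cyclicPattern i j)
           ⊎ (∀ i j → sign (B i j) ≡ negate3 (cyclicPattern i j))

  ClusterCyclic : Mat → Set
  ClusterCyclic B = ∀ w → Reduced w → Cyclic (Bw B w)

  nonneg? : ℝ → Bool
  nonneg? x with 0ℝ ≤? x
  ... | yes _ = true
  ... | no  _ = false

  -- tropical sign ε_i^w: + if c_i^w ≥ 0 componentwise, − otherwise
  -- (for cluster-cyclic B, c_i^w is nonzero and sign-coherent)
  ε : Mat → Seq → I3 → PM
  ε B w i =
    if nonneg? (Cw B w zero i) ∧ nonneg? (Cw B w (suc zero) i)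
         ∧ nonneg? (Cw B w (suc (suc zero)) i)
    then plus else minus

  K : Mat → Seq → I3
  K B w = lastE w

  -- s ≠ k with ε_s sign(b_{ks}) = −1 and ε_k ≠ ε_s (unique by the paper)
  condS : Mat → Seq → I3 → Bool
  condS B w s =
    eq3 (ε B w s · sign (Bw B w (K B w) s)) neg
    ∧ Data.Bool.not (eqPM (ε B w (K B w)) (ε B w s))

  Sᵢ : Mat → Seq → I3
  Sᵢ B w = if condS B w (other₁ (K B w)) then other₁ (K B w) else other₂ (K B w)

  Tᵢ : Mat → Seq → I3
  Tᵢ B w = third (K B w) (Sᵢ B w)

  act : Mat → Seq → Letter → Seq
  act B w S = extend w (Sᵢ B w)
  act B w T = extend w (Tᵢ B w)

  actList : Mat → Seq → List Letter → Seq
  actList B w X = foldl (act B) w X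

  InTrunk : Mat → Seq → Set
  InTrunk B w = Σ I3 λ i → Σ ℕ λ n → w ≡ actList B (i ∷ []) (replicate n S)

  InBranch : Mat → Seq → Set
  InBranch B w = Σ I3 λ i → Σ (List Letter) λ X →
                   (T ∈ X) × (w ≡ actList B (i ∷ []) X)

module Submission where

open import Defs
open import Algebra.Bundles using (CommutativeRing)
open import Algebra.Core using (Op₁; Op₂)
open import Algebra.Solver.Ring.AlmostCommutativeRing
  using (fromCommutativeRing; _-Raw-AlmostCommutative⟶_)
open import Algebra.Structures using (IsCommutativeRing)
open import Data.Bool using (Bool; true; false; if_then_else_; _∧_; not)
open import Data.Bool.Properties using (∧-zeroʳ)
open import Data.Empty using (⊥-elim)
open import Data.Fin using (Fin; zero; suc)
open import Data.Integer as ℤ using (ℤ; 0ℤ; 1ℤ)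
import Data.Integer.Properties as ℤP
open import Data.List using (List; []; _∷_; _++_; foldl; replicate; length)
open import Data.List.Membership.Propositional using (_∈_)
open import Data.List.Properties using (foldl-++; ++-assoc; ++-identityʳ; ++-conicalʳ)
open import Data.List.Relation.Unary.Any using (here; there)
open import Data.Maybe using (Maybe; just; nothing)
open import Data.Nat as ℕ using (ℕ; zero; suc)
import Data.Nat.Properties as ℕP
open import Data.Product using (_×_; _,_; proj₁; proj₂; ∃; ∃₂)
open import Data.Sign as Sign using (Sign)
open import Data.Sum as Sum using (_⊎_; inj₁; inj₂)
open import Function using (_∘_; id)
open import Function.Bundles using (_⇔_; mk⇔)
open import Relation.Binary.Bundles using (TotalOrder)
open import Relation.Binary.PropositionalEquality
  using (_≡_; _≢_; refl; sym; trans; cong; cong₂; subst; subst₂; module ≡-Reasoning)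
open import Relation.Binary.Structures using (IsTotalOrder)
open import Relation.Nullary using (¬_; yes; no)

-- For reduced w ≠ ∅ write (K, S, T) = (k, s, t) and σ = ε_S. Then w satisfies an invariant:
-- σ·b_SK > 0, which by cyclicity of B^w fixes the signs of all its off-diagonal entries
-- (σ-positive along S → K → T → S); the tropical signs are ε_K = −σ, ε_S = σ, and ε_T = σ on
-- a trunk, −σ on a branch; and for every row j, |b_TS|·|c_jK| ≤ |b_TK|·|c_jS|.
-- It holds after the first mutation, and the moves S (mutate at S, swapping the roles of K and
-- S) and T (mutate at T) preserve it. By the sign-coherent mutation rules each new c-vector is
-- minus the pivot column, an old column, or an old column plus a nonnegative multiple of a
-- column of the same sign -- except the new c_S = c_K + |b_SK|·c_S after an S-move, whose sign
-- follows from the magnitude inequality together with the sign of the mutated entry b_TK, which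
-- cyclicity of the next matrix provides. Since the invariant determines which index satisfies
-- the defining condition of S, it yields the relabelling rules (b), and the tropical signs it
-- records give (a).

-- The ring solver decides equality of coefficients by evaluation, so an abstract ring gets
-- integer coefficients, interpreted through the canonical map ι : ℤ → A.
module IntegerCoefficientSolver
  {A : Set} {add mul : Op₂ A} {neg : Op₁ A} {0ᴬ 1ᴬ : A}
  (isCommutativeRing : IsCommutativeRing _≡_ add mul neg 0ᴬ 1ᴬ) where

  private
    ring : CommutativeRing _ _
    ring = record { isCommutativeRing = isCommutativeRing }

    open CommutativeRing ring
      using (_+_; _*_; -_; 0#; 1#; +-comm; +-identityˡ; +-identityʳ; -‿inverseʳ;
             +-abelianGroup; +-commutativeSemigroup; semiring)
      renaming (ring to ring′)
    open import Algebra.Properties.AbelianGroup +-abelianGroup using (⁻¹-∙-comm)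
    open import Algebra.Properties.Group (CommutativeRing.+-group ring)
      using (ε⁻¹≈ε; ⁻¹-involutive)
    open import Algebra.Properties.CommutativeSemigroup +-commutativeSemigroup
      using (interchange)
    open import Algebra.Properties.Ring ring′ using (-‿distribˡ-*; -‿distribʳ-*)
    open import Algebra.Properties.Semiring.Mult.TCOptimised semiring
      using (1+×; ×-homo-+; ×1-homo-*) renaming (_×_ to _·1#_)

    -- With the optimised _×_, nat 1 is 1# itself, so 0-homo and 1-homo hold by refl and the
    -- constants con 0ℤ, con 1ℤ of a solver expression denote 0# and 1#.
    nat : ℕ → A
    nat n = n ·1# 1#

    signed : Sign → A → A
    signed Sign.+ x = x
    signed Sign.- x = - x

    ι : ℤ → A
    ι (ℤ.+ n) = nat n
    ι ℤ.-[1+ n ] = - nat (suc n)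

    ι-◃ : ∀ s n → ι (s ℤ.◃ n) ≡ signed s (nat n)
    ι-◃ Sign.+ ℕ.zero = refl
    ι-◃ Sign.- ℕ.zero = sym ε⁻¹≈ε
    ι-◃ Sign.+ (suc n) = refl
    ι-◃ Sign.- (suc n) = refl

    ι-signAbs : ∀ i → ι i ≡ signed (ℤ.sign i) (nat ℤ.∣ i ∣)
    ι-signAbs (ℤ.+ n) = refl
    ι-signAbs ℤ.-[1+ n ] = refl

    signed-* : ∀ s t x y → signed (s Sign.* t) (x * y) ≡ signed s x * signed t y
    signed-* Sign.+ Sign.+ x y = refl
    signed-* Sign.+ Sign.- x y = -‿distribʳ-* x y
    signed-* Sign.- Sign.+ x y = -‿distribˡ-* x y
    signed-* Sign.- Sign.- x y = begin
      x * y             ≡⟨ sym (⁻¹-involutive _) ⟩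
      - - (x * y)       ≡⟨ cong -_ (-‿distribʳ-* x y) ⟩
      - (x * - y)       ≡⟨ -‿distribˡ-* x (- y) ⟩
      - x * - y         ∎
      where open ≡-Reasoning

    one-plus-cancel : ∀ a b → (1# + a) + - (1# + b) ≡ a + - b
    one-plus-cancel a b = begin
      (1# + a) + - (1# + b)     ≡⟨ cong ((1# + a) +_) (sym (⁻¹-∙-comm 1# b)) ⟩
      (1# + a) + (- 1# + - b)   ≡⟨ interchange 1# a (- 1#) (- b) ⟩
      (1# + - 1#) + (a + - b)   ≡⟨ cong (_+ (a + - b)) (-‿inverseʳ 1#) ⟩
      0# + (a + - b)            ≡⟨ +-identityˡ _ ⟩
      a + - b                   ∎
      where open ≡-Reasoning

    ι-⊖ : ∀ m n → ι (m ℤ.⊖ n) ≡ nat m + - nat n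
    ι-⊖ ℕ.zero ℕ.zero = sym (-‿inverseʳ 0#)
    ι-⊖ (suc m) ℕ.zero = trans (sym (+-identityʳ _)) (cong (nat (suc m) +_) (sym ε⁻¹≈ε))
    ι-⊖ ℕ.zero (suc n) = sym (+-identityˡ _)
    ι-⊖ (suc m) (suc n) = begin
      ι (suc m ℤ.⊖ suc n)                ≡⟨ cong ι (ℤP.[1+m]⊖[1+n]≡m⊖n m n) ⟩
      ι (m ℤ.⊖ n)                        ≡⟨ ι-⊖ m n ⟩
      nat m + - nat n                    ≡⟨ sym (one-plus-cancel (nat m) (nat n)) ⟩
      (1# + nat m) + - (1# + nat n)      ≡⟨ sym (cong₂ (λ x y → x + - y) (1+× m 1#) (1+× n 1#)) ⟩
      nat (suc m) + - nat (suc n)        ∎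
      where open ≡-Reasoning

    ι-+ : ∀ i j → ι (i ℤ.+ j) ≡ ι i + ι j
    ι-+ (ℤ.+ m) (ℤ.+ n) = ×-homo-+ 1# m n
    ι-+ (ℤ.+ m) ℤ.-[1+ n ] = ι-⊖ m (suc n)
    ι-+ ℤ.-[1+ m ] (ℤ.+ n) = trans (ι-⊖ n (suc m)) (+-comm _ _)
    ι-+ ℤ.-[1+ m ] ℤ.-[1+ n ] = begin
      - nat (suc (suc (m ℕ.+ n)))        ≡⟨ cong (λ k → - nat (suc k)) (sym (ℕP.+-suc m n)) ⟩
      - nat (suc m ℕ.+ suc n)            ≡⟨ cong -_ (×-homo-+ 1# (suc m) (suc n)) ⟩
      - (nat (suc m) + nat (suc n))      ≡⟨ sym (⁻¹-∙-comm _ _) ⟩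
      - nat (suc m) + - nat (suc n)      ∎
      where open ≡-Reasoning

    ι-* : ∀ i j → ι (i ℤ.* j) ≡ ι i * ι j
    ι-* i j = begin
      ι (i ℤ.* j)                            ≡⟨ ι-◃ (s Sign.* t) (m ℕ.* n) ⟩
      signed (s Sign.* t) (nat (m ℕ.* n))    ≡⟨ cong (signed (s Sign.* t)) (×1-homo-* m n) ⟩
      signed (s Sign.* t) (nat m * nat n)    ≡⟨ signed-* s t _ _ ⟩
      signed s (nat m) * signed t (nat n)    ≡⟨ sym (cong₂ _*_ (ι-signAbs i) (ι-signAbs j)) ⟩
      ι i * ι j                              ∎
      where
      open ≡-Reasoning
      s t : Sign
      s = ℤ.sign i
      t = ℤ.sign j
      m n : ℕ
      m = ℤ.∣ i ∣
      n = ℤ.∣ j ∣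

    ι-neg : ∀ i → ι (ℤ.- i) ≡ - ι i
    ι-neg (ℤ.+ ℕ.zero) = sym ε⁻¹≈ε
    ι-neg (ℤ.+ suc n) = refl
    ι-neg ℤ.-[1+ n ] = sym (⁻¹-involutive _)

    ι-≟ : ∀ i j → Maybe (ι i ≡ ι j)
    ι-≟ i j with i ℤ.≟ j
    ... | yes refl = just refl
    ... | no _ = nothing

    ι-homomorphism : ℤ.+-*-rawRing -Raw-AlmostCommutative⟶ fromCommutativeRing ring
    ι-homomorphism = record
      { ⟦_⟧ = ι ; +-homo = ι-+ ; *-homo = ι-* ; -‿homo = ι-neg
      ; 0-homo = refl ; 1-homo = refl }

  open import Algebra.Solver.Ring ℤ.+-*-rawRing (fromCommutativeRing ring) ι-homomorphism ι-≟
    public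

-- Indices, orientations and signs

pattern i₁ = zero
pattern i₂ = suc zero
pattern i₃ = suc (suc zero)

data Distinct : I3 → I3 → I3 → Set where
  d₁₂₃ : Distinct i₁ i₂ i₃
  d₁₃₂ : Distinct i₁ i₃ i₂
  d₂₁₃ : Distinct i₂ i₁ i₃
  d₂₃₁ : Distinct i₂ i₃ i₁
  d₃₁₂ : Distinct i₃ i₁ i₂
  d₃₂₁ : Distinct i₃ i₂ i₁

module _ {i j l : I3} where

  Distinct-swap : Distinct i j l → Distinct j i l
  Distinct-swap d₁₂₃ = d₂₁₃
  Distinct-swap d₁₃₂ = d₃₁₂
  Distinct-swap d₂₁₃ = d₁₂₃
  Distinct-swap d₂₃₁ = d₃₂₁
  Distinct-swap d₃₁₂ = d₁₃₂
  Distinct-swap d₃₂₁ = d₂₃₁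

  Distinct-rotate : Distinct i j l → Distinct j l i
  Distinct-rotate d₁₂₃ = d₂₃₁
  Distinct-rotate d₁₃₂ = d₃₂₁
  Distinct-rotate d₂₁₃ = d₁₃₂
  Distinct-rotate d₂₃₁ = d₃₁₂
  Distinct-rotate d₃₁₂ = d₁₂₃
  Distinct-rotate d₃₂₁ = d₂₁₃

  Distinct⇒≢ : Distinct i j l → i ≢ j
  Distinct⇒≢ d₁₂₃ ()
  Distinct⇒≢ d₁₃₂ ()
  Distinct⇒≢ d₂₁₃ ()
  Distinct⇒≢ d₂₃₁ ()
  Distinct⇒≢ d₃₁₂ ()
  Distinct⇒≢ d₃₂₁ ()

  third-Distinct : Distinct i j l → third i j ≡ l
  third-Distinct d₁₂₃ = refl
  third-Distinct d₁₃₂ = refl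
  third-Distinct d₂₁₃ = refl
  third-Distinct d₂₃₁ = refl
  third-Distinct d₃₁₂ = refl
  third-Distinct d₃₂₁ = refl

  cyclicPattern-rotate : Distinct i j l → cyclicPattern i j ≡ cyclicPattern j l
  cyclicPattern-rotate d₁₂₃ = refl
  cyclicPattern-rotate d₁₃₂ = refl
  cyclicPattern-rotate d₂₁₃ = refl
  cyclicPattern-rotate d₂₃₁ = refl
  cyclicPattern-rotate d₃₁₂ = refl
  cyclicPattern-rotate d₃₂₁ = refl

  cyclicPattern-Distinct : Distinct i j l → ∃ λ σ → cyclicPattern i j ≡ σ · pos
  cyclicPattern-Distinct d₁₂₃ = minus , refl
  cyclicPattern-Distinct d₁₃₂ = plus , refl
  cyclicPattern-Distinct d₂₁₃ = plus , refl
  cyclicPattern-Distinct d₂₃₁ = minus , refl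
  cyclicPattern-Distinct d₃₁₂ = minus , refl
  cyclicPattern-Distinct d₃₂₁ = plus , refl

  Distinct-exhaustive : Distinct i j l → ∀ x → x ≡ i ⊎ x ≡ j ⊎ x ≡ l
  Distinct-exhaustive d₁₂₃ i₁ = inj₁ refl
  Distinct-exhaustive d₁₂₃ i₂ = inj₂ (inj₁ refl)
  Distinct-exhaustive d₁₂₃ i₃ = inj₂ (inj₂ refl)
  Distinct-exhaustive d₁₃₂ i₁ = inj₁ refl
  Distinct-exhaustive d₁₃₂ i₂ = inj₂ (inj₂ refl)
  Distinct-exhaustive d₁₃₂ i₃ = inj₂ (inj₁ refl)
  Distinct-exhaustive d₂₁₃ i₁ = inj₂ (inj₁ refl)
  Distinct-exhaustive d₂₁₃ i₂ = inj₁ refl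
  Distinct-exhaustive d₂₁₃ i₃ = inj₂ (inj₂ refl)
  Distinct-exhaustive d₂₃₁ i₁ = inj₂ (inj₂ refl)
  Distinct-exhaustive d₂₃₁ i₂ = inj₁ refl
  Distinct-exhaustive d₂₃₁ i₃ = inj₂ (inj₁ refl)
  Distinct-exhaustive d₃₁₂ i₁ = inj₂ (inj₁ refl)
  Distinct-exhaustive d₃₁₂ i₂ = inj₂ (inj₂ refl)
  Distinct-exhaustive d₃₁₂ i₃ = inj₁ refl
  Distinct-exhaustive d₃₂₁ i₁ = inj₂ (inj₂ refl)
  Distinct-exhaustive d₃₂₁ i₂ = inj₂ (inj₁ refl)
  Distinct-exhaustive d₃₂₁ i₃ = inj₁ refl

  select-other : Distinct i j l → (c : I3 → Bool) → c j ≡ true → c l ≡ false →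
                 (if c (other₁ i) then other₁ i else other₂ i) ≡ j
  select-other d₁₂₃ c cj cl rewrite cj = refl
  select-other d₁₃₂ c cj cl rewrite cl = refl
  select-other d₂₁₃ c cj cl rewrite cj = refl
  select-other d₂₃₁ c cj cl rewrite cl = refl
  select-other d₃₁₂ c cj cl rewrite cj = refl
  select-other d₃₂₁ c cj cl rewrite cl = refl

Distinct-third : ∀ {i j} → i ≢ j → Distinct i j (third i j)
Distinct-third {i₁} {i₁} i≢j = ⊥-elim (i≢j refl)
Distinct-third {i₁} {i₂} _ = d₁₂₃
Distinct-third {i₁} {i₃} _ = d₁₃₂
Distinct-third {i₂} {i₁} _ = d₂₁₃
Distinct-third {i₂} {i₂} i≢j = ⊥-elim (i≢j refl)
Distinct-third {i₂} {i₃} _ = d₂₃₁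
Distinct-third {i₃} {i₁} _ = d₃₁₂
Distinct-third {i₃} {i₂} _ = d₃₂₁
Distinct-third {i₃} {i₃} i≢j = ⊥-elim (i≢j refl)

other₁-≢ : ∀ i → other₁ i ≢ i
other₁-≢ i₁ ()
other₁-≢ i₂ ()
other₁-≢ i₃ ()

cyclicPattern-skew : ∀ i j → cyclicPattern j i ≡ negate3 (cyclicPattern i j)
cyclicPattern-skew i₁ i₁ = refl
cyclicPattern-skew i₁ i₂ = refl
cyclicPattern-skew i₁ i₃ = refl
cyclicPattern-skew i₂ i₁ = refl
cyclicPattern-skew i₂ i₂ = refl
cyclicPattern-skew i₂ i₃ = refl
cyclicPattern-skew i₃ i₁ = refl
cyclicPattern-skew i₃ i₂ = refl
cyclicPattern-skew i₃ i₃ = refl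

cyclicPattern-diagonal : ∀ i → cyclicPattern i i ≡ zer
cyclicPattern-diagonal i₁ = refl
cyclicPattern-diagonal i₂ = refl
cyclicPattern-diagonal i₃ = refl

eqF-refl : ∀ {n} (i : Fin n) → eqF i i ≡ true
eqF-refl zero = refl
eqF-refl (suc i) = eqF-refl i

eqF-≢ : ∀ {n} {i j : Fin n} → i ≢ j → eqF i j ≡ false
eqF-≢ {i = zero} {zero} i≢j = ⊥-elim (i≢j refl)
eqF-≢ {i = zero} {suc j} _ = refl
eqF-≢ {i = suc i} {zero} _ = refl
eqF-≢ {i = suc i} {suc j} i≢j = eqF-≢ (i≢j ∘ cong suc)

if-eqF-refl : ∀ {A : Set} {n} (i : Fin n) {x y : A} → (if eqF i i then x else y) ≡ x
if-eqF-refl i rewrite eqF-refl i = refl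

if-eqF-≢ : ∀ {A : Set} {n} {i j : Fin n} {x y : A} → i ≢ j → (if eqF i j then x else y) ≡ y
if-eqF-≢ i≢j rewrite eqF-≢ i≢j = refl

opposite : PM → PM
opposite plus = minus
opposite minus = plus

opposite-involutive : ∀ σ → opposite (opposite σ) ≡ σ
opposite-involutive plus = refl
opposite-involutive minus = refl

opposite-≢ : ∀ σ → opposite σ ≢ σ
opposite-≢ plus ()
opposite-≢ minus ()

negate3-·pos : ∀ σ → negate3 (σ · pos) ≡ opposite σ · pos
negate3-·pos plus = refl
negate3-·pos minus = refl

data Part : Set where
  trunk branch : Part

-- ε_T on a trunk and on a branch, when ε_S = σ.
signT : Part → PM → PM
signT trunk σ = σ
signT branch σ = opposite σ

S-condition : ∀ {εs sgn εk} σ → εs ≡ σ → sgn ≡ opposite σ · pos → εk ≡ opposite σ →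
              eq3 (εs · sgn) neg ∧ not (eqPM εk εs) ≡ true
S-condition plus refl refl refl = refl
S-condition minus refl refl refl = refl

T-condition : ∀ {εt sgn εk} p σ → εt ≡ signT p σ → sgn ≡ σ · pos → εk ≡ opposite σ →
              eq3 (εt · sgn) neg ∧ not (eqPM εk εt) ≡ false
T-condition trunk plus refl refl refl = refl
T-condition trunk minus refl refl refl = refl
T-condition branch plus refl refl refl = refl
T-condition branch minus refl refl refl = refl

≢opposite⇔·pos : ∀ {εk sgn} e σ → εk ≡ opposite σ → sgn ≡ σ · pos → (¬ e ≡ εk) ⇔ (e · sgn ≡ pos)
≢opposite⇔·pos plus plus refl refl = mk⇔ (λ _ → refl) (λ _ ())
≢opposite⇔·pos plus minus refl refl = mk⇔ (λ e≢εk → ⊥-elim (e≢εk refl)) (λ ())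
≢opposite⇔·pos minus plus refl refl = mk⇔ (λ e≢εk → ⊥-elim (e≢εk refl)) (λ ())
≢opposite⇔·pos minus minus refl refl = mk⇔ (λ _ → refl) (λ _ ())

≡opposite⇔·neg : ∀ {εk sgn} e σ → εk ≡ opposite σ → sgn ≡ σ · pos → (e ≡ εk) ⇔ (e · sgn ≡ neg)
≡opposite⇔·neg plus plus refl refl = mk⇔ (λ ()) (λ ())
≡opposite⇔·neg plus minus refl refl = mk⇔ (λ _ → refl) (λ _ → refl)
≡opposite⇔·neg minus plus refl refl = mk⇔ (λ _ → refl) (λ _ → refl)
≡opposite⇔·neg minus minus refl refl = mk⇔ (λ ()) (λ ())

-- Reduced sequences and words in S and T

extend-snoc : ∀ w {x} → w ≢ [] → lastE w ≢ x → extend w x ≡ w ++ x ∷ []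
extend-snoc [] w≢[] _ = ⊥-elim (w≢[] refl)
extend-snoc (y ∷ []) _ y≢x rewrite eqF-≢ y≢x = refl
extend-snoc (y ∷ z ∷ zs) _ last≢x = cong (y ∷_) (extend-snoc (z ∷ zs) (λ ()) last≢x)

lastE-snoc : ∀ w x → lastE (w ++ x ∷ []) ≡ x
lastE-snoc [] x = refl
lastE-snoc (y ∷ []) x = refl
lastE-snoc (y ∷ z ∷ zs) x = lastE-snoc (z ∷ zs) x

Reduced-snoc : ∀ {w x} → Reduced w → w ≢ [] → lastE w ≢ x → Reduced (w ++ x ∷ [])
Reduced-snoc r[] w≢[] _ = ⊥-elim (w≢[] refl)
Reduced-snoc r[ y ] _ y≢x = r∷ y≢x r[ _ ]
Reduced-snoc (r∷ y≢z r) _ last≢x = r∷ y≢z (Reduced-snoc r (λ ()) last≢x)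

Reduced⇒lastE≢ : ∀ w {x L} → Reduced (w ++ x ∷ L) → w ≢ [] → lastE w ≢ x
Reduced⇒lastE≢ [] _ w≢[] = ⊥-elim (w≢[] refl)
Reduced⇒lastE≢ (y ∷ []) (r∷ y≢x _) _ = y≢x
Reduced⇒lastE≢ (y ∷ z ∷ zs) (r∷ _ r) _ = Reduced⇒lastE≢ (z ∷ zs) r (λ ())

T∈⊎Sⁿ : ∀ X → T ∈ X ⊎ X ≡ replicate (length X) S
T∈⊎Sⁿ [] = inj₂ refl
T∈⊎Sⁿ (S ∷ X) = Sum.map there (cong (S ∷_)) (T∈⊎Sⁿ X)
T∈⊎Sⁿ (T ∷ X) = inj₁ (here refl)

_after_ : Part → List Letter → Part
p after [] = p
p after (S ∷ X) = p after X
p after (T ∷ X) = branch after X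

after-Sⁿ : ∀ p n → p after replicate n S ≡ p
after-Sⁿ p zero = refl
after-Sⁿ p (suc n) = after-Sⁿ p n

branch-after : ∀ X → branch after X ≡ branch
branch-after [] = refl
branch-after (S ∷ X) = branch-after X
branch-after (T ∷ X) = branch-after X

after-T∈ : ∀ p {X} → T ∈ X → p after X ≡ branch
after-T∈ p {T ∷ X} (here refl) = branch-after X
after-T∈ p {S ∷ X} (there T∈X) = after-T∈ p T∈X
after-T∈ p {T ∷ X} (there _) = branch-after X

-- Ordered fields

module OrderedField (R : RealNumbers) where
  open RealNumbers R hiding (_<_)

  -- The same relation as RealNumbers._<_, re-exported with the fixity of _≤_.
  infix 4 _<_
  _<_ : ℝ → ℝ → Set
  _<_ = RealNumbers._<_ R
  open Cluster R using (sign; pos⁺; nonneg?)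

  open IntegerCoefficientSolver isCommutativeRing public
  open IsTotalOrder isTotalOrder public using ()
    renaming (antisym to ≤-antisym; trans to ≤-trans; reflexive to ≤-reflexive)
  open IsCommutativeRing isCommutativeRing using (+-comm)

  ℝ-ring : CommutativeRing _ _
  ℝ-ring = record { isCommutativeRing = isCommutativeRing }

  ℝ-totalOrder : TotalOrder _ _ _
  ℝ-totalOrder = record { isTotalOrder = isTotalOrder }

  open import Relation.Binary.Properties.TotalOrder ℝ-totalOrder using (≰⇒>)

  open CommutativeRing ℝ-ring public
    using (+-identityˡ; +-identityʳ; -‿inverseʳ; zeroˡ; zeroʳ; *-identityʳ)
  open import Algebra.Properties.Group (CommutativeRing.+-group ℝ-ring) public
    using (ε⁻¹≈ε; ⁻¹-involutive)

  ≤-refl : ∀ {x} → x ≤ x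
  ≤-refl = ≤-reflexive refl

  <-≤-trans : ∀ {x y z} → x < y → y ≤ z → x < z
  <-≤-trans (x≤y , x≢y) y≤z = ≤-trans x≤y y≤z , λ { refl → x≢y (≤-antisym x≤y y≤z) }

  +-mono : ∀ {a b c d} → a ≤ b → c ≤ d → a + c ≤ b + d
  +-mono {a} {b} {c} {d} a≤b c≤d = ≤-trans (+-mono-≤ c a≤b)
    (subst₂ _≤_ (+-comm c b) (+-comm d b) (+-mono-≤ b c≤d))

  0≤-+ : ∀ {a b} → 0ℝ ≤ a → 0ℝ ≤ b → 0ℝ ≤ a + b
  0≤-+ {a} {b} 0≤a 0≤b = subst (_≤ a + b) (+-identityˡ 0ℝ) (+-mono 0≤a 0≤b)

  0<-+ : ∀ {a b} → 0ℝ < a → 0ℝ ≤ b → 0ℝ < a + b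
  0<-+ {a} {b} 0<a 0≤b = <-≤-trans 0<a (subst (_≤ a + b) (+-identityʳ a) (+-mono ≤-refl 0≤b))

  ≤-by-difference : ∀ {a b} d → b + - a ≡ d → 0ℝ ≤ d → a ≤ b
  ≤-by-difference {a} {b} d b-a≡d 0≤d = subst₂ _≤_ (+-identityˡ a)
    (trans (cong (_+ a) (sym b-a≡d)) (solve 2 (λ a b → b :- a :+ a := b) refl a b))
    (+-mono-≤ a 0≤d)

  ≤⇒0≤-difference : ∀ {a b} → a ≤ b → 0ℝ ≤ b + - a
  ≤⇒0≤-difference {a} a≤b = subst (_≤ _) (-‿inverseʳ a) (+-mono-≤ (- a) a≤b)

  neg-0≤ : ∀ {a} → a ≤ 0ℝ → 0ℝ ≤ - a
  neg-0≤ {a} a≤0 = subst₂ _≤_ (-‿inverseʳ a) (+-identityˡ (- a)) (+-mono-≤ (- a) a≤0)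

  neg-≤0 : ∀ {a} → 0ℝ ≤ a → - a ≤ 0ℝ
  neg-≤0 {a} 0≤a = subst₂ _≤_ (+-identityˡ (- a)) (-‿inverseʳ a) (+-mono-≤ (- a) 0≤a)

  neg-0≤⁻¹ : ∀ {x} → 0ℝ ≤ - x → x ≤ 0ℝ
  neg-0≤⁻¹ {x} 0≤-x = subst (_≤ 0ℝ) (⁻¹-involutive x) (neg-≤0 0≤-x)

  neg-≤0⁻¹ : ∀ {x} → - x ≤ 0ℝ → 0ℝ ≤ x
  neg-≤0⁻¹ {x} -x≤0 = subst (0ℝ ≤_) (⁻¹-involutive x) (neg-0≤ -x≤0)

  *-cancel-zero : ∀ {a b} → a ≢ 0ℝ → a * b ≡ 0ℝ → b ≡ 0ℝ
  *-cancel-zero {a} {b} a≢0 ab≡0 with inverse a a≢0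
  ... | a⁻¹ , aa⁻¹≡1 = begin
    b               ≡⟨ solve 1 (λ b → b := con 1ℤ :* b) refl b ⟩
    1ℝ * b          ≡⟨ cong (_* b) (sym aa⁻¹≡1) ⟩
    a * a⁻¹ * b     ≡⟨ solve 3 (λ a a⁻¹ b → a :* a⁻¹ :* b := a⁻¹ :* (a :* b)) refl a a⁻¹ b ⟩
    a⁻¹ * (a * b)   ≡⟨ cong (a⁻¹ *_) ab≡0 ⟩
    a⁻¹ * 0ℝ        ≡⟨ zeroʳ a⁻¹ ⟩
    0ℝ              ∎
    where open ≡-Reasoning

  *-pos : ∀ {a b} → 0ℝ < a → 0ℝ < b → 0ℝ < a * b
  *-pos (0≤a , 0≢a) (0≤b , 0≢b) =
    *-nonneg 0≤a 0≤b , λ 0≡ab → 0≢b (sym (*-cancel-zero (0≢a ∘ sym) (sym 0≡ab)))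

  *-cancelˡ-nonneg : ∀ {r x} → 0ℝ < r → 0ℝ ≤ r * x → 0ℝ ≤ x
  *-cancelˡ-nonneg {r} {x} (0≤r , 0≢r) 0≤rx with IsTotalOrder.total isTotalOrder 0ℝ x
  ... | inj₁ 0≤x = 0≤x
  ... | inj₂ x≤0 = ≤-reflexive (sym (*-cancel-zero (0≢r ∘ sym) (≤-antisym rx≤0 0≤rx)))
    where
    rx≤0 : r * x ≤ 0ℝ
    rx≤0 = subst (_≤ 0ℝ) (solve 2 (λ r x → :- (r :* :- x) := r :* x) refl r x)
                 (neg-≤0 (*-nonneg 0≤r (neg-0≤ x≤0)))

  *-cancelˡ-pos : ∀ {r x} → 0ℝ < r → 0ℝ < r * x → 0ℝ < x
  *-cancelˡ-pos {r} 0<r (0≤rx , 0≢rx) =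
    *-cancelˡ-nonneg 0<r 0≤rx , λ { refl → 0≢rx (sym (zeroʳ r)) }

  0<1 : 0ℝ < 1ℝ
  0<1 with IsTotalOrder.total isTotalOrder 0ℝ 1ℝ
  ... | inj₁ 0≤1 = 0≤1 , 0≢1
  ... | inj₂ 1≤0 = ⊥-elim (0≢1 (≤-antisym 0≤1 1≤0))
    where
    0≤1 : 0ℝ ≤ 1ℝ
    0≤1 = subst (0ℝ ≤_) (solve 0 (:- con 1ℤ :* :- con 1ℤ := con 1ℤ) refl)
                (*-nonneg (neg-0≤ 1≤0) (neg-0≤ 1≤0))

  neg-<0 : ∀ {x} → 0ℝ < x → - x < 0ℝ
  neg-<0 {x} (0≤x , 0≢x) = neg-≤0 0≤x , λ -x≡0 → 0≢x (sym (begin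
    x       ≡⟨ sym (⁻¹-involutive x) ⟩
    - - x   ≡⟨ cong -_ -x≡0 ⟩
    - 0ℝ    ≡⟨ ε⁻¹≈ε ⟩
    0ℝ      ∎))
    where open ≡-Reasoning

  neg-0< : ∀ {x} → x < 0ℝ → 0ℝ < - x
  neg-0< {x} (x≤0 , x≢0) = neg-0≤ x≤0 , λ 0≡-x → x≢0 (begin
    x       ≡⟨ sym (⁻¹-involutive x) ⟩
    - - x   ≡⟨ cong -_ (sym 0≡-x) ⟩
    - 0ℝ    ≡⟨ ε⁻¹≈ε ⟩
    0ℝ      ∎)
    where open ≡-Reasoning

  0<-⇒<0 : ∀ {x} → 0ℝ < - x → x < 0ℝ
  0<-⇒<0 {x} 0<-x = subst (_< 0ℝ) (⁻¹-involutive x) (neg-<0 0<-x)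

  sign-pos : ∀ {x} → 0ℝ < x → sign x ≡ pos
  sign-pos {x} (0≤x , 0≢x) with x ≤? 0ℝ
  ... | yes x≤0 = ⊥-elim (0≢x (≤-antisym 0≤x x≤0))
  ... | no _ = refl

  sign-neg : ∀ {x} → x < 0ℝ → sign x ≡ neg
  sign-neg {x} (x≤0 , x≢0) with x ≤? 0ℝ | 0ℝ ≤? x
  ... | yes _ | yes 0≤x = ⊥-elim (x≢0 (≤-antisym x≤0 0≤x))
  ... | yes _ | no _ = refl
  ... | no x≰0 | _ = ⊥-elim (x≰0 x≤0)

  sign-pos⁻¹ : ∀ {x} → sign x ≡ pos → 0ℝ < x
  sign-pos⁻¹ {x} sign≡pos with x ≤? 0ℝ | 0ℝ ≤? x
  sign-pos⁻¹ () | yes _ | yes _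
  sign-pos⁻¹ () | yes _ | no _
  ... | no x≰0 | _ = ≰⇒> x≰0

  sign-neg⁻¹ : ∀ {x} → sign x ≡ neg → x < 0ℝ
  sign-neg⁻¹ {x} sign≡neg with x ≤? 0ℝ | 0ℝ ≤? x
  sign-neg⁻¹ () | yes _ | yes _
  ... | yes x≤0 | no 0≰x = x≤0 , λ { refl → 0≰x x≤0 }
  sign-neg⁻¹ () | no _ | _

  sign-zer⁻¹ : ∀ {x} → sign x ≡ zer → x ≡ 0ℝ
  sign-zer⁻¹ {x} sign≡zer with x ≤? 0ℝ | 0ℝ ≤? x
  ... | yes x≤0 | yes 0≤x = ≤-antisym x≤0 0≤x
  sign-zer⁻¹ () | yes _ | no _
  sign-zer⁻¹ () | no _ | _

  pos⁺-nonneg : ∀ {a} → 0ℝ ≤ a → pos⁺ a ≡ a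
  pos⁺-nonneg {a} 0≤a with 0ℝ ≤? a
  ... | yes _ = refl
  ... | no 0≰a = ⊥-elim (0≰a 0≤a)

  pos⁺-nonpos : ∀ {a} → a ≤ 0ℝ → pos⁺ a ≡ 0ℝ
  pos⁺-nonpos {a} a≤0 with 0ℝ ≤? a
  ... | yes 0≤a = ≤-antisym a≤0 0≤a
  ... | no _ = refl

  nonneg?-nonneg : ∀ {x} → 0ℝ ≤ x → nonneg? x ≡ true
  nonneg?-nonneg {x} 0≤x with 0ℝ ≤? x
  ... | yes _ = refl
  ... | no 0≰x = ⊥-elim (0≰x 0≤x)

  nonneg?-neg : ∀ {x} → x < 0ℝ → nonneg? x ≡ false
  nonneg?-neg {x} (x≤0 , x≢0) with 0ℝ ≤? x
  ... | yes 0≤x = ⊥-elim (x≢0 (≤-antisym x≤0 0≤x))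
  ... | no _ = refl

  infixr 8 _◃_
  _◃_ : PM → ℝ → ℝ
  plus ◃ x = x
  minus ◃ x = - x

  opposite-◃ : ∀ σ x → opposite σ ◃ x ≡ - (σ ◃ x)
  opposite-◃ plus x = refl
  opposite-◃ minus x = sym (⁻¹-involutive x)

  ◃-neg : ∀ σ x → σ ◃ - x ≡ opposite σ ◃ x
  ◃-neg plus x = refl
  ◃-neg minus x = ⁻¹-involutive x

  opposite-◃-neg : ∀ σ x → opposite σ ◃ - x ≡ σ ◃ x
  opposite-◃-neg plus x = ⁻¹-involutive x
  opposite-◃-neg minus x = refl

  ◃-+* : ∀ σ a b c → σ ◃ (a + b * c) ≡ σ ◃ a + b * σ ◃ c
  ◃-+* plus a b c = refl
  ◃-+* minus a b c = solve 3 (λ a b c → :- (a :+ b :* c) := :- a :+ b :* :- c) refl a b c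

  opposite-◃-pos⇒◃-nonpos : ∀ σ {x} → 0ℝ < opposite σ ◃ x → σ ◃ x ≤ 0ℝ
  opposite-◃-pos⇒◃-nonpos σ {x} (0≤-σx , _) =
    subst (_≤ 0ℝ) (⁻¹-involutive _) (neg-≤0 (subst (0ℝ ≤_) (opposite-◃ σ x) 0≤-σx))

  ◃-pos⇒sign : ∀ σ {x} → 0ℝ < σ ◃ x → sign x ≡ σ · pos
  ◃-pos⇒sign plus = sign-pos
  ◃-pos⇒sign minus = sign-neg ∘ 0<-⇒<0

  sign⇒◃-pos : ∀ σ {x} → sign x ≡ σ · pos → 0ℝ < σ ◃ x
  sign⇒◃-pos plus = sign-pos⁻¹
  sign⇒◃-pos minus = neg-0< ∘ sign-neg⁻¹

  record HasSign (σ : PM) (v : I3 → ℝ) : Set where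
    constructor has-sign
    field
      nonneg  : ∀ j → 0ℝ ≤ σ ◃ v j
      nonzero : ∃ λ j → 0ℝ < σ ◃ v j

  HasSign-cong : ∀ {σ u v} → (∀ j → u j ≡ v j) → HasSign σ u → HasSign σ v
  HasSign-cong {σ} u≗v (has-sign 0≤u (j , 0<uj)) = has-sign
    (λ i → subst (λ x → 0ℝ ≤ σ ◃ x) (u≗v i) (0≤u i)) (j , subst (λ x → 0ℝ < σ ◃ x) (u≗v j) 0<uj)

  HasSign-neg : ∀ {σ v} → HasSign σ v → HasSign (opposite σ) (λ j → - v j)
  HasSign-neg {σ} {v} (has-sign 0≤v (j , 0<vj)) = has-sign
    (λ i → subst (0ℝ ≤_) (sym (opposite-◃-neg σ (v i))) (0≤v i))
    (j , subst (0ℝ <_) (sym (opposite-◃-neg σ (v j))) 0<vj)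

  HasSign-+* : ∀ {σ v} {z : I3 → ℝ} q → HasSign σ v → 0ℝ ≤ q → (∀ j → 0ℝ ≤ σ ◃ z j) →
               HasSign σ (λ j → v j + q * z j)
  HasSign-+* {σ} {v} {z} q (has-sign 0≤v (j , 0<vj)) 0≤q 0≤z = has-sign
    (λ i → subst (0ℝ ≤_) (sym (◃-+* σ (v i) q (z i))) (0≤-+ (0≤v i) (*-nonneg 0≤q (0≤z i))))
    (j , subst (0ℝ <_) (sym (◃-+* σ (v j) q (z j))) (0<-+ 0<vj (*-nonneg 0≤q (0≤z j))))

  tropical-sign : ∀ {σ v} → HasSign σ v →
    (if nonneg? (v i₁) ∧ nonneg? (v i₂) ∧ nonneg? (v i₃) then plus else minus) ≡ σ
  tropical-sign {plus} (has-sign 0≤v _)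
    rewrite nonneg?-nonneg (0≤v i₁) | nonneg?-nonneg (0≤v i₂) | nonneg?-nonneg (0≤v i₃) = refl
  tropical-sign {minus} (has-sign _ (i₁ , 0<-v)) rewrite nonneg?-neg (0<-⇒<0 0<-v) = refl
  tropical-sign {minus} {v} (has-sign _ (i₂ , 0<-v))
    rewrite nonneg?-neg (0<-⇒<0 0<-v) | ∧-zeroʳ (nonneg? (v i₁)) = refl
  tropical-sign {minus} {v} (has-sign _ (i₃ , 0<-v))
    rewrite nonneg?-neg (0<-⇒<0 0<-v) | ∧-zeroʳ (nonneg? (v i₂)) | ∧-zeroʳ (nonneg? (v i₁)) = refl

-- Entries of mutated matrices

module MutationFormulas (R : RealNumbers) where
  open RealNumbers R hiding (_<_)
  open Cluster R
  open OrderedField R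
  open IsCommutativeRing isCommutativeRing using (distribˡ; distribʳ)

  Σ₃ : (I3 → ℝ) → ℝ
  Σ₃ f = f i₁ + f i₂ + f i₃

  Σ₃-single : ∀ f j → (∀ l → l ≢ j → f l ≡ 0ℝ) → Σ₃ f ≡ f j
  Σ₃-single f i₁ f≡0 rewrite f≡0 i₂ (λ ()) | f≡0 i₃ (λ ()) =
    solve 1 (λ x → x :+ con 0ℤ :+ con 0ℤ := x) refl (f i₁)
  Σ₃-single f i₂ f≡0 rewrite f≡0 i₁ (λ ()) | f≡0 i₃ (λ ()) =
    solve 1 (λ x → con 0ℤ :+ x :+ con 0ℤ := x) refl (f i₂)
  Σ₃-single f i₃ f≡0 rewrite f≡0 i₁ (λ ()) | f≡0 i₂ (λ ()) =
    solve 1 (λ x → con 0ℤ :+ con 0ℤ :+ x := x) refl (f i₃)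

  Σ₃-+ : ∀ f g → Σ₃ (λ l → f l + g l) ≡ Σ₃ f + Σ₃ g
  Σ₃-+ f g = solve 6 (λ a b c a′ b′ c′ → (a :+ a′) :+ (b :+ b′) :+ (c :+ c′)
                                       := (a :+ b :+ c) :+ (a′ :+ b′ :+ c′))
                     refl (f i₁) (f i₂) (f i₃) (g i₁) (g i₂) (g i₃)

  Σ₃-cong : ∀ {f g} → (∀ l → f l ≡ g l) → Σ₃ f ≡ Σ₃ g
  Σ₃-cong f≗g = cong₂ _+_ (cong₂ _+_ (f≗g i₁) (f≗g i₂)) (f≗g i₃)

  ⊗-distribˡ-⊕ : ∀ A M N i j → (A ⊗ (M ⊕ N)) i j ≡ (A ⊗ M) i j + (A ⊗ N) i j
  ⊗-distribˡ-⊕ A M N i j =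
    trans (Σ₃-cong (λ l → distribˡ (A i l) (M l j) (N l j)))
          (Σ₃-+ (λ l → A i l * M l j) (λ l → A i l * N l j))

  ⊗-distribʳ-⊕ : ∀ A N M i j → ((A ⊕ N) ⊗ M) i j ≡ (A ⊗ M) i j + (N ⊗ M) i j
  ⊗-distribʳ-⊕ A N M i j =
    trans (Σ₃-cong (λ l → distribʳ (M l j) (A i l) (N i l)))
          (Σ₃-+ (λ l → A i l * M l j) (λ l → N i l * M l j))

  Jdiag : I3 → I3 → ℝ
  Jdiag k i = if eqF i k then - 1ℝ else 1ℝ

  Jdiag-pivot : ∀ k → Jdiag k k ≡ - 1ℝ
  Jdiag-pivot k = if-eqF-refl k

  Jdiag-≢ : ∀ {k i} → i ≢ k → Jdiag k i ≡ 1ℝ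
  Jdiag-≢ = if-eqF-≢

  ⊗-J : ∀ A k i j → (A ⊗ J k) i j ≡ A i j * Jdiag k j
  ⊗-J A k i j = trans
    (Σ₃-single (λ l → A i l * J k l j) j
               (λ l l≢j → trans (cong (A i l *_) (if-eqF-≢ l≢j)) (zeroʳ _)))
    (cong (A i j *_) (if-eqF-refl j))

  J-⊗ : ∀ M k i j → (J k ⊗ M) i j ≡ Jdiag k i * M i j
  J-⊗ M k i j = trans
    (Σ₃-single (λ l → J k i l * M l j) i
               (λ l l≢i → trans (cong (_* M l j) (if-eqF-≢ (l≢i ∘ sym))) (zeroˡ _)))
    (cong (_* M i j) (if-eqF-refl i))

  ⊗-row : ∀ A P k i j → (A ⊗ row k P) i j ≡ A i k * P k j
  ⊗-row A P k i j = trans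
    (Σ₃-single (λ l → A i l * row k P l j) k
               (λ l l≢k → trans (cong (A i l *_) (if-eqF-≢ l≢k)) (zeroʳ _)))
    (cong (A i k *_) (if-eqF-refl k))

  col-⊗ : ∀ N M k i j → (col k N ⊗ M) i j ≡ N i k * M k j
  col-⊗ N M k i j = trans
    (Σ₃-single (λ l → col k N i l * M l j) k
               (λ l l≢k → trans (cong (_* M l j) (if-eqF-≢ l≢k)) (zeroˡ _)))
    (cong (_* M k j) (if-eqF-refl k))

  μ-entry : ∀ k M i j → μ k M i j ≡
    (Jdiag k i * M i j + pos⁺ (- M i k) * M k j) * Jdiag k j
    + (Jdiag k i * M i k + pos⁺ (- M i k) * M k k) * pos⁺ (M k j)
  μ-entry k M i j = begin
    μ k M i j
      ≡⟨ ⊗-distribˡ-⊕ L (J k) (row k (posM M)) i j ⟩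
    (L ⊗ J k) i j + (L ⊗ row k (posM M)) i j
      ≡⟨ cong₂ _+_ (⊗-J L k i j) (⊗-row L (posM M) k i j) ⟩
    L i j * Jdiag k j + L i k * pos⁺ (M k j)
      ≡⟨ cong₂ (λ a b → a * Jdiag k j + b * pos⁺ (M k j)) (L-entry j) (L-entry k) ⟩
    (Jdiag k i * M i j + pos⁺ (- M i k) * M k j) * Jdiag k j
      + (Jdiag k i * M i k + pos⁺ (- M i k) * M k k) * pos⁺ (M k j) ∎
    where
    open ≡-Reasoning
    L : Mat
    L = (J k ⊕ col k (posM (negM M))) ⊗ M
    L-entry : ∀ l → L i l ≡ Jdiag k i * M i l + pos⁺ (- M i k) * M k l
    L-entry l = trans (⊗-distribʳ-⊕ (J k) (col k (posM (negM M))) M i l)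
                      (cong₂ _+_ (J-⊗ M k i l) (col-⊗ (posM (negM M)) M k i l))

  μC : Mat → Mat → I3 → Mat
  μC M C k = proj₂ (stepBC (M , C) k)

  μC-entry : ∀ M C k j i →
    μC M C k j i ≡ C j i * Jdiag k i + C j k * pos⁺ (M k i) + pos⁺ (- C j k) * M k i
  μC-entry M C k j i =
    cong₂ _+_ (cong₂ _+_ (⊗-J C k j i) (⊗-row C (posM M) k j i)) (col-⊗ (posM (negM C)) M k j i)

  μ-pivot-col : ∀ M {k i} → M k k ≡ 0ℝ → i ≢ k → μ k M i k ≡ - M i k
  μ-pivot-col M {k} {i} Mkk≡0 i≢k = trans (μ-entry k M i k)
    (identity (Jdiag-≢ i≢k) (Jdiag-pivot k) Mkk≡0 (trans (cong pos⁺ Mkk≡0) (pos⁺-nonpos ≤-refl)))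
    where
    identity : ∀ {d e z q} → d ≡ 1ℝ → e ≡ - 1ℝ → z ≡ 0ℝ → q ≡ 0ℝ →
               (d * M i k + pos⁺ (- M i k) * z) * e + (d * M i k + pos⁺ (- M i k) * z) * q ≡ - M i k
    identity refl refl refl refl =
      solve 2 (λ m p → (con 1ℤ :* m :+ p :* con 0ℤ) :* :- con 1ℤ
                       :+ (con 1ℤ :* m :+ p :* con 0ℤ) :* con 0ℤ := :- m)
              refl (M i k) (pos⁺ (- M i k))

  μ-off-pivot : ∀ M {k i j} → M k k ≡ 0ℝ → i ≢ k → j ≢ k →
                μ k M i j ≡ M i j + pos⁺ (- M i k) * M k j + M i k * pos⁺ (M k j)
  μ-off-pivot M {k} {i} {j} Mkk≡0 i≢k j≢k =
    trans (μ-entry k M i j) (identity (Jdiag-≢ i≢k) (Jdiag-≢ j≢k) Mkk≡0)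
    where
    a p b c q : ℝ
    a = M i j ; p = pos⁺ (- M i k) ; b = M k j ; c = M i k ; q = pos⁺ (M k j)
    identity : ∀ {d e z} → d ≡ 1ℝ → e ≡ 1ℝ → z ≡ 0ℝ →
               (d * a + p * b) * e + (d * c + p * z) * q ≡ a + p * b + c * q
    identity refl refl refl =
      solve 5 (λ a p b c q → (con 1ℤ :* a :+ p :* b) :* con 1ℤ :+ (con 1ℤ :* c :+ p :* con 0ℤ) :* q
                             := a :+ p :* b :+ c :* q)
              refl a p b c q

  μC-pivot : ∀ M C j {k} → M k k ≡ 0ℝ → μC M C k j k ≡ - C j k
  μC-pivot M C j {k} Mkk≡0 = trans (μC-entry M C k j k)
    (identity (Jdiag-pivot k) (trans (cong pos⁺ Mkk≡0) (pos⁺-nonpos ≤-refl)) Mkk≡0)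
    where
    identity : ∀ {d q z} → d ≡ - 1ℝ → q ≡ 0ℝ → z ≡ 0ℝ →
               C j k * d + C j k * q + pos⁺ (- C j k) * z ≡ - C j k
    identity refl refl refl =
      solve 2 (λ c p → c :* :- con 1ℤ :+ c :* con 0ℤ :+ p :* con 0ℤ := :- c)
              refl (C j k) (pos⁺ (- C j k))

  μC-off-pivot : ∀ M C j {k i} → i ≢ k →
                 μC M C k j i ≡ C j i + C j k * pos⁺ (M k i) + pos⁺ (- C j k) * M k i
  μC-off-pivot M C j {k} {i} i≢k = trans (μC-entry M C k j i)
    (cong (λ x → x + C j k * pos⁺ (M k i) + pos⁺ (- C j k) * M k i)
          (trans (cong (C j i *_) (Jdiag-≢ i≢k)) (*-identityʳ (C j i))))

  μ-coherent : ∀ σ M {m i j} → M m m ≡ 0ℝ → i ≢ m → j ≢ m →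
               0ℝ ≤ σ ◃ M i m → 0ℝ ≤ σ ◃ M m j →
               σ ◃ μ m M i j ≡ σ ◃ M i j + σ ◃ M i m * σ ◃ M m j
  μ-coherent plus M {m} {i} {j} Mmm≡0 i≢m j≢m 0≤Mim 0≤Mmj =
    trans (μ-off-pivot M Mmm≡0 i≢m j≢m) (identity (pos⁺-nonpos (neg-≤0 0≤Mim)) (pos⁺-nonneg 0≤Mmj))
    where
    identity : ∀ {x y} → x ≡ 0ℝ → y ≡ M m j → M i j + x * M m j + M i m * y ≡ M i j + M i m * M m j
    identity refl refl =
      solve 3 (λ a b c → a :+ con 0ℤ :* c :+ b :* c := a :+ b :* c) refl (M i j) (M i m) (M m j)
  μ-coherent minus M {m} {i} {j} Mmm≡0 i≢m j≢m 0≤-Mim 0≤-Mmj =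
    trans (cong -_ (μ-off-pivot M Mmm≡0 i≢m j≢m))
          (identity (pos⁺-nonneg 0≤-Mim) (pos⁺-nonpos (neg-0≤⁻¹ 0≤-Mmj)))
    where
    identity : ∀ {x y} → x ≡ - M i m → y ≡ 0ℝ →
               - (M i j + x * M m j + M i m * y) ≡ - M i j + - M i m * - M m j
    identity refl refl =
      solve 3 (λ a b c → :- (a :+ :- b :* c :+ b :* con 0ℤ) := :- a :+ :- b :* :- c)
              refl (M i j) (M i m) (M m j)

  μC-along : ∀ σ M C j {m i} → i ≢ m → 0ℝ ≤ σ ◃ C j m → 0ℝ ≤ σ ◃ M m i →
             μC M C m j i ≡ C j i + σ ◃ M m i * C j m
  μC-along plus M C j {m} {i} i≢m 0≤Cjm 0≤Mmi =
    trans (μC-off-pivot M C j i≢m) (identity (pos⁺-nonneg 0≤Mmi) (pos⁺-nonpos (neg-≤0 0≤Cjm)))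
    where
    identity : ∀ {x y} → x ≡ M m i → y ≡ 0ℝ → C j i + C j m * x + y * M m i ≡ C j i + M m i * C j m
    identity refl refl =
      solve 3 (λ a c b → a :+ c :* b :+ con 0ℤ :* b := a :+ b :* c) refl (C j i) (C j m) (M m i)
  μC-along minus M C j {m} {i} i≢m 0≤-Cjm 0≤-Mmi =
    trans (μC-off-pivot M C j i≢m) (identity (pos⁺-nonpos (neg-0≤⁻¹ 0≤-Mmi)) (pos⁺-nonneg 0≤-Cjm))
    where
    identity : ∀ {x y} → x ≡ 0ℝ → y ≡ - C j m →
               C j i + C j m * x + y * M m i ≡ C j i + - M m i * C j m
    identity refl refl =
      solve 3 (λ a c b → a :+ c :* con 0ℤ :+ :- c :* b := a :+ :- b :* c)
              refl (C j i) (C j m) (M m i)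

  μC-against : ∀ σ M C j {m i} → i ≢ m → 0ℝ ≤ σ ◃ C j m → σ ◃ M m i ≤ 0ℝ →
               μC M C m j i ≡ C j i
  μC-against plus M C j {m} {i} i≢m 0≤Cjm Mmi≤0 =
    trans (μC-off-pivot M C j i≢m) (identity (pos⁺-nonpos Mmi≤0) (pos⁺-nonpos (neg-≤0 0≤Cjm)))
    where
    identity : ∀ {x y} → x ≡ 0ℝ → y ≡ 0ℝ → C j i + C j m * x + y * M m i ≡ C j i
    identity refl refl =
      solve 3 (λ a c b → a :+ c :* con 0ℤ :+ con 0ℤ :* b := a) refl (C j i) (C j m) (M m i)
  μC-against minus M C j {m} {i} i≢m 0≤-Cjm -Mmi≤0 =
    trans (μC-off-pivot M C j i≢m) (identity (pos⁺-nonneg (neg-≤0⁻¹ -Mmi≤0)) (pos⁺-nonneg 0≤-Cjm))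
    where
    identity : ∀ {x y} → x ≡ M m i → y ≡ - C j m → C j i + C j m * x + y * M m i ≡ C j i
    identity refl refl =
      solve 3 (λ a c b → a :+ c :* b :+ :- c :* b := a) refl (C j i) (C j m) (M m i)

-- The invariant along trunks and branches

module Invariants (R : RealNumbers) where
  open RealNumbers R hiding (_<_)
  open Cluster R
  open OrderedField R
  open MutationFormulas R

  Cyclic-skew : ∀ {M} → Cyclic M → ∀ i j → sign (M j i) ≡ negate3 (sign (M i j))
  Cyclic-skew (inj₁ h) i j =
    trans (h j i) (trans (cyclicPattern-skew i j) (cong negate3 (sym (h i j))))
  Cyclic-skew (inj₂ h) i j =
    trans (h j i) (cong negate3 (trans (cyclicPattern-skew i j) (sym (h i j))))

  Cyclic-rotate : ∀ {M i j l} → Cyclic M → Distinct i j l → sign (M i j) ≡ sign (M j l)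
  Cyclic-rotate {i = i} {j} {l} (inj₁ h) d =
    trans (h i j) (trans (cyclicPattern-rotate d) (sym (h j l)))
  Cyclic-rotate {i = i} {j} {l} (inj₂ h) d =
    trans (h i j) (trans (cong negate3 (cyclicPattern-rotate d)) (sym (h j l)))

  Cyclic-diagonal : ∀ {M} → Cyclic M → ∀ i → M i i ≡ 0ℝ
  Cyclic-diagonal (inj₁ h) i = sign-zer⁻¹ (trans (h i i) (cyclicPattern-diagonal i))
  Cyclic-diagonal (inj₂ h) i = sign-zer⁻¹ (trans (h i i) (cong negate3 (cyclicPattern-diagonal i)))

  Cyclic-nonzero : ∀ {M i j l} → Cyclic M → Distinct i j l → ∃ λ σ → 0ℝ < σ ◃ M i j
  Cyclic-nonzero {i = i} {j} (inj₁ h) d with cyclicPattern-Distinct d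
  ... | σ , e = σ , sign⇒◃-pos σ (trans (h i j) e)
  Cyclic-nonzero {i = i} {j} (inj₂ h) d with cyclicPattern-Distinct d
  ... | σ , e = opposite σ ,
    sign⇒◃-pos (opposite σ) (trans (h i j) (trans (cong negate3 e) (negate3-·pos σ)))

  Cyclic-reverse : ∀ {M i j} σ → Cyclic M → 0ℝ < σ ◃ M i j → 0ℝ < opposite σ ◃ M j i
  Cyclic-reverse {i = i} {j} σ cyclic 0<Mij = sign⇒◃-pos (opposite σ)
    (trans (Cyclic-skew cyclic i j) (trans (cong negate3 (◃-pos⇒sign σ 0<Mij)) (negate3-·pos σ)))

  record Oriented (M : Mat) (σ : PM) (i j l : I3) : Set where
    field
      pos₂₃ : 0ℝ < σ ◃ M j l
      pos₃₁ : 0ℝ < σ ◃ M l i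
      neg₂₁ : 0ℝ < opposite σ ◃ M j i
      neg₃₂ : 0ℝ < opposite σ ◃ M l j
      neg₁₃ : 0ℝ < opposite σ ◃ M i l

  oriented : ∀ {M i j l} σ → Cyclic M → Distinct i j l → 0ℝ < σ ◃ M i j → Oriented M σ i j l
  oriented {M} {i} {j} {l} σ cyclic d 0<Mij = record
    { pos₂₃ = 0<Mjl ; pos₃₁ = 0<Mli
    ; neg₂₁ = Cyclic-reverse σ cyclic 0<Mij
    ; neg₃₂ = Cyclic-reverse σ cyclic 0<Mjl
    ; neg₁₃ = Cyclic-reverse σ cyclic 0<Mli }
    where
    rotate-pos : ∀ {a b c} → Distinct a b c → 0ℝ < σ ◃ M a b → 0ℝ < σ ◃ M b c
    rotate-pos d 0<Mab = sign⇒◃-pos σ (trans (sym (Cyclic-rotate cyclic d)) (◃-pos⇒sign σ 0<Mab))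
    0<Mjl : 0ℝ < σ ◃ M j l
    0<Mjl = rotate-pos d 0<Mij
    0<Mli : 0ℝ < σ ◃ M l i
    0<Mli = rotate-pos (Distinct-rotate d) 0<Mjl

  pivot-inequality : ∀ {x A r X Z} → x ≤ 0ℝ → 0ℝ ≤ A → 0ℝ ≤ X → 0ℝ ≤ Z →
                     (x + A * r) * Z ≤ A * (X + r * Z)
  pivot-inequality {x} {A} {r} {X} {Z} x≤0 0≤A 0≤X 0≤Z = ≤-by-difference (A * X + - x * Z)
    (solve 5 (λ x A r X Z → A :* (X :+ r :* Z) :- (x :+ A :* r) :* Z := A :* X :+ :- x :* Z)
           refl x A r X Z)
    (0≤-+ (*-nonneg 0≤A 0≤X) (*-nonneg (neg-0≤ x≤0) 0≤Z))

  swap-inequality : ∀ {a r β u X} → r * - u ≤ - a * X → (a + r * β) * X ≤ r * (u + β * X)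
  swap-inequality {a} {r} {β} {u} {X} ru≤aX = ≤-by-difference (- a * X + - (r * - u))
    (solve 5 (λ a r β u X → r :* (u :+ β :* X) :- (a :+ r :* β) :* X := :- a :* X :- r :* :- u)
           refl a r β u X)
    (≤⇒0≤-difference ru≤aX)

  swap-coherent : ∀ {a r β u X} → 0ℝ < r → 0ℝ < a + r * β → r * - u ≤ - a * X →
                  (0ℝ ≤ X → 0ℝ ≤ u + β * X) × (0ℝ < X → 0ℝ < u + β * X)
  swap-coherent 0<r 0<a+rβ ru≤aX =
    (λ 0≤X → *-cancelˡ-nonneg 0<r (≤-trans (*-nonneg (proj₁ 0<a+rβ) 0≤X) (swap-inequality ru≤aX))) ,
    (λ 0<X → *-cancelˡ-pos 0<r (<-≤-trans (*-pos 0<a+rβ 0<X) (swap-inequality ru≤aX)))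

  column : Mat → I3 → (I3 → ℝ)
  column C i j = C j i

  -- At w: (M, C) = (B^w, C^w), (k, s, t) = (K, S, T) and σ = ε_S; magnitude reads
  -- |b_TS|·|c_jK| ≤ |b_TK|·|c_jS|.
  record Invariant (M C : Mat) (k s t : I3) (σ : PM) (p : Part) : Set where
    field
      distinct    : Distinct k s t
      sk-positive : 0ℝ < σ ◃ M s k
      c-k         : HasSign (opposite σ) (column C k)
      c-s         : HasSign σ (column C s)
      c-t         : HasSign (signT p σ) (column C t)
      magnitude   : ∀ j → σ ◃ M t s * opposite σ ◃ C j k ≤ opposite σ ◃ M t k * σ ◃ C j s

  -- Covers both T-moves and the first mutation of (B, I).
  invariant-after-pivot : ∀ {M C m a b σ} p → Cyclic M → Distinct m a b → 0ℝ < σ ◃ M m a →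
    HasSign σ (column C m) → HasSign σ (column C a) → HasSign (signT p σ) (column C b) →
    Invariant (μ m M) (μC M C m) m a b σ p
  invariant-after-pivot {M} {C} {m} {a} {b} {σ} p cyclic d 0<Mma c-m c-a c-b = record
    { distinct    = d
    ; sk-positive = subst (0ℝ <_) (sym (trans (cong (σ ◃_) (μ-pivot-col M Mmm≡0 a≢m)) (◃-neg σ _)))
                          (Oriented.neg₂₁ O)
    ; c-k         = HasSign-cong (λ j → sym (μC-pivot M C j Mmm≡0)) (HasSign-neg c-m)
    ; c-s         = HasSign-cong (λ j → sym (C′-a j))
                                 (HasSign-+* (σ ◃ M m a) c-a (proj₁ 0<Mma) 0≤Cm)
    ; c-t         = HasSign-cong (λ j → sym (μC-against σ M C j b≢m (0≤Cm j) Mmb≤0)) c-b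
    ; magnitude   = λ j → subst₂ _≤_ (sym (cong₂ _*_ M′-ba (Z′ j))) (sym (cong₂ _*_ M′-bm (X′ j)))
        (pivot-inequality (opposite-◃-pos⇒◃-nonpos σ (Oriented.neg₃₂ O)) (proj₁ (Oriented.pos₃₁ O))
                          (HasSign.nonneg c-a j) (0≤Cm j))
    }
    where
    O : Oriented M σ m a b
    O = oriented σ cyclic d 0<Mma
    Mmm≡0 : M m m ≡ 0ℝ
    Mmm≡0 = Cyclic-diagonal cyclic m
    a≢m : a ≢ m
    a≢m = Distinct⇒≢ d ∘ sym
    b≢m : b ≢ m
    b≢m = Distinct⇒≢ (Distinct-rotate (Distinct-rotate d))
    0≤Cm : ∀ j → 0ℝ ≤ σ ◃ C j m
    0≤Cm = HasSign.nonneg c-m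
    Mmb≤0 : σ ◃ M m b ≤ 0ℝ
    Mmb≤0 = opposite-◃-pos⇒◃-nonpos σ (Oriented.neg₁₃ O)
    C′-a : ∀ j → μC M C m j a ≡ C j a + σ ◃ M m a * C j m
    C′-a j = μC-along σ M C j a≢m (0≤Cm j) (proj₁ 0<Mma)
    M′-ba : σ ◃ μ m M b a ≡ σ ◃ M b a + σ ◃ M b m * σ ◃ M m a
    M′-ba = μ-coherent σ M Mmm≡0 b≢m a≢m (proj₁ (Oriented.pos₃₁ O)) (proj₁ 0<Mma)
    M′-bm : opposite σ ◃ μ m M b m ≡ σ ◃ M b m
    M′-bm = trans (cong (opposite σ ◃_) (μ-pivot-col M Mmm≡0 b≢m)) (opposite-◃-neg σ _)
    Z′ : ∀ j → opposite σ ◃ μC M C m j m ≡ σ ◃ C j m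
    Z′ j = trans (cong (opposite σ ◃_) (μC-pivot M C j Mmm≡0)) (opposite-◃-neg σ _)
    X′ : ∀ j → σ ◃ μC M C m j a ≡ σ ◃ C j a + σ ◃ M m a * σ ◃ C j m
    X′ j = trans (cong (σ ◃_) (C′-a j)) (◃-+* σ _ _ _)

  -- Cyclicity of μ s M makes σ·b′_TK = σ·b_TK + |b_TS|·|b_SK| positive; with magnitude this
  -- forces the new c_S = c_K + |b_SK|·c_S to have sign σ.
  invariant-after-swap : ∀ {M C k s t σ p} → Cyclic M → Cyclic (μ s M) →
    Invariant M C k s t σ p → Invariant (μ s M) (μC M C s) s k t σ p
  invariant-after-swap {M} {C} {k} {s} {t} {σ} {p} cyclic cyclic′ I = record
    { distinct    = d′
    ; sk-positive = 0<M′ks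
    ; c-k         = HasSign-cong (λ j → sym (μC-pivot M C j Mss≡0)) (HasSign-neg c-s)
    ; c-s         = has-sign (λ j → subst (0ℝ ≤_) (sym (C′-k j)) (proj₁ (coherent j) (0≤Cs j)))
                             (j₀ , subst (0ℝ <_) (sym (C′-k j₀)) (proj₂ (coherent j₀) 0<Cj₀s))
    ; c-t         = HasSign-cong (λ j → sym (μC-against σ M C j t≢s (0≤Cs j) Mst≤0)) c-t
    ; magnitude   = λ j → subst₂ _≤_ (sym (cong₂ _*_ M′-tk (X′ j))) (sym (cong₂ _*_ M′-ts (C′-k j)))
                                     (swap-inequality (magnitude′ j))
    }
    where
    open Invariant I
    d′ : Distinct s k t
    d′ = Distinct-swap distinct
    O : Oriented M σ s k t
    O = oriented σ cyclic d′ sk-positive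
    Mss≡0 : M s s ≡ 0ℝ
    Mss≡0 = Cyclic-diagonal cyclic s
    k≢s : k ≢ s
    k≢s = Distinct⇒≢ distinct
    t≢s : t ≢ s
    t≢s = Distinct⇒≢ (Distinct-rotate (Distinct-rotate d′))
    0≤Cs : ∀ j → 0ℝ ≤ σ ◃ C j s
    0≤Cs = HasSign.nonneg c-s
    j₀ : I3
    j₀ = proj₁ (HasSign.nonzero c-s)
    0<Cj₀s : 0ℝ < σ ◃ C j₀ s
    0<Cj₀s = proj₂ (HasSign.nonzero c-s)
    Mst≤0 : σ ◃ M s t ≤ 0ℝ
    Mst≤0 = opposite-◃-pos⇒◃-nonpos σ (Oriented.neg₁₃ O)
    0<M′ks : 0ℝ < σ ◃ μ s M k s
    0<M′ks = subst (0ℝ <_) (sym (trans (cong (σ ◃_) (μ-pivot-col M Mss≡0 k≢s)) (◃-neg σ _)))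
                   (Oriented.neg₂₁ O)
    M′-tk : σ ◃ μ s M t k ≡ σ ◃ M t k + σ ◃ M t s * σ ◃ M s k
    M′-tk = μ-coherent σ M Mss≡0 t≢s k≢s (proj₁ (Oriented.pos₃₁ O)) (proj₁ sk-positive)
    M′-ts : opposite σ ◃ μ s M t s ≡ σ ◃ M t s
    M′-ts = trans (cong (opposite σ ◃_) (μ-pivot-col M Mss≡0 t≢s)) (opposite-◃-neg σ _)
    X′ : ∀ j → opposite σ ◃ μC M C s j s ≡ σ ◃ C j s
    X′ j = trans (cong (opposite σ ◃_) (μC-pivot M C j Mss≡0)) (opposite-◃-neg σ _)
    C′-k : ∀ j → σ ◃ μC M C s j k ≡ σ ◃ C j k + σ ◃ M s k * σ ◃ C j s
    C′-k j = trans (cong (σ ◃_) (μC-along σ M C j k≢s (0≤Cs j) (proj₁ sk-positive))) (◃-+* σ _ _ _)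
    magnitude′ : ∀ j → σ ◃ M t s * - (σ ◃ C j k) ≤ - (σ ◃ M t k) * σ ◃ C j s
    magnitude′ j = subst₂ _≤_ (cong (σ ◃ M t s *_) (opposite-◃ σ _))
                              (cong (_* σ ◃ C j s) (opposite-◃ σ _)) (magnitude j)
    0<M′tk : 0ℝ < σ ◃ M t k + σ ◃ M t s * σ ◃ M s k
    0<M′tk = subst (0ℝ <_) M′-tk (Oriented.pos₃₁ (oriented σ cyclic′ distinct 0<M′ks))
    coherent : ∀ j → let u = σ ◃ C j k ; X = σ ◃ C j s ; β = σ ◃ M s k in
               (0ℝ ≤ X → 0ℝ ≤ u + β * X) × (0ℝ < X → 0ℝ < u + β * X)
    coherent j = swap-coherent (Oriented.pos₃₁ O) 0<M′tk (magnitude′ j)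

  invariant-after-T-trunk : ∀ {M C k s t σ} → Cyclic M → Invariant M C k s t σ trunk →
    Invariant (μ t M) (μC M C t) t s k σ branch
  invariant-after-T-trunk {M} {k = k} {s} {t} {σ} cyclic I = invariant-after-pivot branch cyclic
    (Distinct-swap (Distinct-rotate distinct)) (Oriented.pos₃₁ O) c-t c-s c-k
    where
    open Invariant I
    O : Oriented M σ s k t
    O = oriented σ cyclic (Distinct-swap distinct) sk-positive

  invariant-after-T-branch : ∀ {M C k s t σ} → Cyclic M → Invariant M C k s t σ branch →
    Invariant (μ t M) (μC M C t) t k s (opposite σ) branch
  invariant-after-T-branch {M} {C} {k} {s} {t} {σ} cyclic I = invariant-after-pivot branch cyclic
    (Distinct-rotate (Distinct-rotate distinct)) (Oriented.neg₃₂ O) c-t c-k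
    (subst (λ τ → HasSign τ (column C s)) (sym (opposite-involutive σ)) c-s)
    where
    open Invariant I
    O : Oriented M σ s k t
    O = oriented σ cyclic (Distinct-swap distinct) sk-positive

  HasSign-Id : ∀ i → HasSign plus (column Id i)
  HasSign-Id i = has-sign nonneg (i , subst (0ℝ <_) (sym (if-eqF-refl i)) 0<1)
    where
    nonneg : ∀ j → 0ℝ ≤ Id j i
    nonneg j with eqF j i
    ... | true = proj₁ 0<1
    ... | false = ≤-refl

  initial-invariant : ∀ {M} → Cyclic M → ∀ k →
    ∃₂ λ s t → Invariant (μ k M) (μC M Id k) k s t plus trunk
  initial-invariant {M} cyclic k = from-orientation (Cyclic-nonzero cyclic d)
    where
    d : Distinct k (other₁ k) (third k (other₁ k))
    d = Distinct-third (other₁-≢ k ∘ sym)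
    from-orientation : (∃ λ σ → 0ℝ < σ ◃ M k (other₁ k)) →
                       ∃₂ λ s t → Invariant (μ k M) (μC M Id k) k s t plus trunk
    from-orientation (plus , 0<Mks) = _ , _ ,
      invariant-after-pivot {C = Id} trunk cyclic d 0<Mks
        (HasSign-Id _) (HasSign-Id _) (HasSign-Id _)
    from-orientation (minus , 0<-Mks) = _ , _ ,
      invariant-after-pivot {C = Id} trunk cyclic d′ (Oriented.neg₁₃ (oriented minus cyclic d 0<-Mks))
        (HasSign-Id _) (HasSign-Id _) (HasSign-Id _)
      where
      d′ : Distinct k (third k (other₁ k)) (other₁ k)
      d′ = Distinct-swap (Distinct-rotate (Distinct-rotate d))

-- Walking along a reduced sequence

module Walks (R : RealNumbers) (B : Cluster.Mat R) (cc : Cluster.ClusterCyclic R B) where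
  open RealNumbers R hiding (_<_)
  open Cluster R
  open OrderedField R
  open MutationFormulas R
  open Invariants R

  Bw-snoc : ∀ w x → Bw B (w ++ x ∷ []) ≡ μ x (Bw B w)
  Bw-snoc w x = foldl-++ (λ M k → μ k M) B w (x ∷ [])

  proj₁-foldl-stepBC : ∀ M C w → proj₁ (foldl stepBC (M , C) w) ≡ foldl (λ M k → μ k M) M w
  proj₁-foldl-stepBC M C [] = refl
  proj₁-foldl-stepBC M C (x ∷ w) = proj₁-foldl-stepBC (μ x M) (μC M C x) w

  Cw-snoc : ∀ w x → Cw B (w ++ x ∷ []) ≡ μC (Bw B w) (Cw B w) x
  Cw-snoc w x = trans (cong proj₂ (foldl-++ stepBC (B , Id) w (x ∷ [])))
                      (cong (λ M → μC M (Cw B w) x) (proj₁-foldl-stepBC B Id w))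

  record Walk (w : Seq) (k s t : I3) (σ : PM) (p : Part) : Set where
    field
      reduced   : Reduced w
      nonempty  : w ≢ []
      last      : lastE w ≡ k
      invariant : Invariant (Bw B w) (Cw B w) k s t σ p

  SomeWalk : Seq → Part → Set
  SomeWalk w p = ∃ λ k → ∃ λ s → ∃ λ t → ∃ λ σ → Walk w k s t σ p

  initial-walk : ∀ i → SomeWalk (i ∷ []) trunk
  initial-walk i with initial-invariant (cc [] r[]) i
  ... | s , t , I = i , s , t , plus , record
    { reduced = r[ i ] ; nonempty = λ () ; last = refl ; invariant = I }

  module _ {w k s t σ p} (W : Walk w k s t σ p) where
    open Walk W
    private
      I : Invariant (Bw B w) (Cw B w) (K B w) s t σ p
      I = subst (λ k → Invariant (Bw B w) (Cw B w) k s t σ p) (sym last) invariant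
      open Invariant I
      O : Oriented (Bw B w) σ s (K B w) t
      O = oriented σ (cc w reduced) (Distinct-swap distinct) sk-positive

    ε-K : ε B w (K B w) ≡ opposite σ
    ε-K = tropical-sign c-k

    ε-S : ε B w s ≡ σ
    ε-S = tropical-sign c-s

    ε-T : ε B w t ≡ signT p σ
    ε-T = tropical-sign c-t

    sign-KT : sign (Bw B w (K B w) t) ≡ σ · pos
    sign-KT = ◃-pos⇒sign σ (Oriented.pos₂₃ O)

    S≡ : Sᵢ B w ≡ s
    S≡ = select-other distinct (condS B w)
      (S-condition σ ε-S (◃-pos⇒sign (opposite σ) (Oriented.neg₂₁ O)) ε-K)
      (T-condition p σ ε-T sign-KT ε-K)

    T≡ : Tᵢ B w ≡ t
    T≡ = trans (cong (third (K B w)) S≡) (third-Distinct distinct)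

    KST≡ : (K B w , Sᵢ B w , Tᵢ B w) ≡ (k , s , t)
    KST≡ = cong₂ _,_ last (cong₂ _,_ S≡ T≡)

    ε-Tᵢ : ε B w (Tᵢ B w) ≡ signT p σ
    ε-Tᵢ = trans (cong (ε B w) T≡) ε-T

    ε-Sᵢ : ε B w (Sᵢ B w) ≡ σ
    ε-Sᵢ = trans (cong (ε B w) S≡) ε-S

    sign-KTᵢ : sign (Bw B w (K B w) (Tᵢ B w)) ≡ σ · pos
    sign-KTᵢ = trans (cong (sign ∘ Bw B w (K B w)) T≡) sign-KT

  module _ {w k s t σ p} (W : Walk w k s t σ p) where
    open Walk W
    open Invariant invariant using (distinct)

    private
      last≢ : ∀ {x} → x ≢ k → lastE w ≢ x
      last≢ x≢k lastE≡x = x≢k (trans (sym lastE≡x) last)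

      s≢k : s ≢ k
      s≢k = Distinct⇒≢ distinct ∘ sym

      t≢k : t ≢ k
      t≢k = Distinct⇒≢ (Distinct-rotate (Distinct-rotate distinct))

    walk-snoc : ∀ {x s′ t′ σ′ p′} → x ≢ k →
      (Cyclic (μ x (Bw B w)) → Invariant (μ x (Bw B w)) (μC (Bw B w) (Cw B w) x) x s′ t′ σ′ p′) →
      Walk (w ++ x ∷ []) x s′ t′ σ′ p′
    walk-snoc {x} x≢k next = record
      { reduced   = reduced′
      ; nonempty  = (λ ()) ∘ ++-conicalʳ w (x ∷ [])
      ; last      = lastE-snoc w x
      ; invariant = subst₂ (λ M C → Invariant M C x _ _ _ _) (sym (Bw-snoc w x)) (sym (Cw-snoc w x))
                           (next (subst Cyclic (Bw-snoc w x) (cc _ reduced′)))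
      }
      where
      reduced′ : Reduced (w ++ x ∷ [])
      reduced′ = Reduced-snoc reduced nonempty (last≢ x≢k)

    act-S : act B w S ≡ w ++ s ∷ []
    act-S = trans (cong (extend w) (S≡ W)) (extend-snoc w nonempty (last≢ s≢k))

    act-T : act B w T ≡ w ++ t ∷ []
    act-T = trans (cong (extend w) (T≡ W)) (extend-snoc w nonempty (last≢ t≢k))

    walk-S : Walk (act B w S) s k t σ p
    walk-S = subst (λ v → Walk v s k t σ p) (sym act-S)
      (walk-snoc s≢k (λ cyclic′ → invariant-after-swap (cc w reduced) cyclic′ invariant))

    walk-T′ : ∀ {s′ t′ σ′} →
      Invariant (μ t (Bw B w)) (μC (Bw B w) (Cw B w) t) t s′ t′ σ′ branch →
      Walk (act B w T) t s′ t′ σ′ branch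
    walk-T′ I = subst (λ v → Walk v t _ _ _ branch) (sym act-T) (walk-snoc t≢k (λ _ → I))

  walk-T-trunk : ∀ {w k s t σ} → Walk w k s t σ trunk → Walk (act B w T) t s k σ branch
  walk-T-trunk W = walk-T′ W (invariant-after-T-trunk (cc _ (Walk.reduced W)) (Walk.invariant W))

  walk-T-branch : ∀ {w k s t σ} → Walk w k s t σ branch → Walk (act B w T) t k s (opposite σ) branch
  walk-T-branch W = walk-T′ W (invariant-after-T-branch (cc _ (Walk.reduced W)) (Walk.invariant W))

  walk-T : ∀ {w k s t σ p} → Walk w k s t σ p → SomeWalk (act B w T) branch
  walk-T {p = trunk} W = _ , _ , _ , _ , walk-T-trunk W
  walk-T {p = branch} W = _ , _ , _ , _ , walk-T-branch W

  walk-along : ∀ {w k s t σ p} → Walk w k s t σ p → ∀ X → SomeWalk (actList B w X) (p after X)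
  walk-along W [] = _ , _ , _ , _ , W
  walk-along W (S ∷ X) = walk-along (walk-S W) X
  walk-along W (T ∷ X) with walk-T W
  ... | _ , _ , _ , _ , W′ = walk-along W′ X

  prepend-letter : ∀ {w x L} l → act B w l ≡ w ++ x ∷ [] →
    ∃ (λ X → act B w l ++ L ≡ actList B (act B w l) X) → ∃ λ X → w ++ x ∷ L ≡ actList B w X
  prepend-letter {w} {x} {L} l e (X , eq) =
    l ∷ X , trans (sym (++-assoc w (x ∷ []) L)) (trans (cong (_++ L) (sym e)) eq)

  Reduced-regroup : ∀ {w x L v} → Reduced (w ++ x ∷ L) → v ≡ w ++ x ∷ [] → Reduced (v ++ L)
  Reduced-regroup {w} {x} {L} r refl = subst Reduced (sym (++-assoc w (x ∷ []) L)) r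

  decompose : ∀ {w k s t σ p} → Walk w k s t σ p → ∀ L → Reduced (w ++ L) →
              ∃ λ X → w ++ L ≡ actList B w X
  decompose {w} W [] _ = [] , ++-identityʳ w
  decompose {w} W (x ∷ L) r with Distinct-exhaustive (Invariant.distinct (Walk.invariant W)) x
  ... | inj₁ refl = ⊥-elim (Reduced⇒lastE≢ w r (Walk.nonempty W) (Walk.last W))
  ... | inj₂ (inj₁ refl) =
    prepend-letter S (act-S W) (decompose (walk-S W) L (Reduced-regroup r (act-S W)))
  ... | inj₂ (inj₂ refl) with walk-T W
  ...   | _ , _ , _ , _ , W′ =
    prepend-letter T (act-T W) (decompose W′ L (Reduced-regroup r (act-T W)))

  every-sequence : ∀ {w} → Reduced w → w ≢ [] → ∃₂ λ i X → w ≡ actList B (i ∷ []) X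
  every-sequence {[]} _ []≢[] = ⊥-elim ([]≢[] refl)
  every-sequence {i ∷ L} r _ with initial-walk i
  ... | _ , _ , _ , _ , W = i , decompose W L r

  trunk-or-branch : ∀ {w} → Reduced w → w ≢ [] → InTrunk B w ⊎ InBranch B w
  trunk-or-branch r w≢[] with every-sequence r w≢[]
  ... | i , X , w≡iX with T∈⊎Sⁿ X
  ...   | inj₁ T∈X = inj₂ (i , X , T∈X , w≡iX)
  ...   | inj₂ X≡Sⁿ = inj₁ (i , length X , trans w≡iX (cong (actList B (i ∷ [])) X≡Sⁿ))

  walk-in-trunk : ∀ {w} → InTrunk B w → SomeWalk w trunk
  walk-in-trunk (i , n , refl) with initial-walk i
  ... | _ , _ , _ , _ , W = subst (SomeWalk _) (after-Sⁿ trunk n) (walk-along W (replicate n S))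

  walk-in-branch : ∀ {w} → InBranch B w → SomeWalk w branch
  walk-in-branch (i , X , T∈X , refl) with initial-walk i
  ... | _ , _ , _ , _ , W = subst (SomeWalk _) (after-T∈ trunk T∈X) (walk-along W X)

  some-walk : ∀ {w} → Reduced w → w ≢ [] → ∃ (SomeWalk w)
  some-walk r w≢[] with trunk-or-branch r w≢[]
  ... | inj₁ in-trunk = trunk , walk-in-trunk in-trunk
  ... | inj₂ in-branch = branch , walk-in-branch in-branch

  εT≢εK-in-trunk : ∀ {w} → SomeWalk w trunk → ¬ ε B w (Tᵢ B w) ≡ ε B w (K B w)
  εT≢εK-in-trunk (_ , _ , _ , σ , W) εT≡εK =
    opposite-≢ σ (trans (sym (ε-K W)) (trans (sym εT≡εK) (ε-Tᵢ W)))

  εT≡εK-in-branch : ∀ {w} → SomeWalk w branch → ε B w (Tᵢ B w) ≡ ε B w (K B w)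
  εT≡εK-in-branch (_ , _ , _ , _ , W) = trans (ε-Tᵢ W) (sym (ε-K W))

  module _ {w} (r : Reduced w) (w≢[] : w ≢ []) where

    trunk⇔εT≢εK : InTrunk B w ⇔ (¬ ε B w (Tᵢ B w) ≡ ε B w (K B w))
    trunk⇔εT≢εK = mk⇔ (εT≢εK-in-trunk ∘ walk-in-trunk) λ εT≢εK →
      Sum.[ id , (λ in-branch → ⊥-elim (εT≢εK (εT≡εK-in-branch (walk-in-branch in-branch)))) ]′
        (trunk-or-branch r w≢[])

    branch⇔εT≡εK : InBranch B w ⇔ (ε B w (Tᵢ B w) ≡ ε B w (K B w))
    branch⇔εT≡εK = mk⇔ (εT≡εK-in-branch ∘ walk-in-branch) λ εT≡εK →
      Sum.[ (λ in-trunk → ⊥-elim (εT≢εK-in-trunk (walk-in-trunk in-trunk) εT≡εK)) , id ]′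
        (trunk-or-branch r w≢[])

    εT≢εK⇔sign-pos : (¬ ε B w (Tᵢ B w) ≡ ε B w (K B w))
                     ⇔ (ε B w (Tᵢ B w) · sign (Bw B w (K B w) (Tᵢ B w)) ≡ pos)
    εT≢εK⇔sign-pos = let (_ , _ , _ , _ , σ , W) = some-walk r w≢[] in
      ≢opposite⇔·pos (ε B w (Tᵢ B w)) σ (ε-K W) (sign-KTᵢ W)

    εT≡εK⇔sign-neg : (ε B w (Tᵢ B w) ≡ ε B w (K B w))
                     ⇔ (ε B w (Tᵢ B w) · sign (Bw B w (K B w) (Tᵢ B w)) ≡ neg)
    εT≡εK⇔sign-neg = let (_ , _ , _ , _ , σ , W) = some-walk r w≢[] in
      ≡opposite⇔·neg (ε B w (Tᵢ B w)) σ (ε-K W) (sign-KTᵢ W)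

    εK≢εS : ¬ ε B w (K B w) ≡ ε B w (Sᵢ B w)
    εK≢εS εK≡εS = let (_ , _ , _ , _ , σ , W) = some-walk r w≢[] in
      opposite-≢ σ (trans (sym (ε-K W)) (trans εK≡εS (ε-Sᵢ W)))

    relabel-S : (K B (act B w S) , Sᵢ B (act B w S) , Tᵢ B (act B w S)) ≡ (Sᵢ B w , K B w , Tᵢ B w)
    relabel-S = let (_ , _ , _ , _ , _ , W) = some-walk r w≢[] in
      trans (KST≡ (walk-S W)) (sym (cong₂ _,_ (S≡ W) (cong₂ _,_ (Walk.last W) (T≡ W))))

  relabel-T-trunk : ∀ {w} → InTrunk B w →
    (K B (act B w T) , Sᵢ B (act B w T) , Tᵢ B (act B w T)) ≡ (Tᵢ B w , Sᵢ B w , K B w)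
  relabel-T-trunk in-trunk = let (_ , _ , _ , _ , W) = walk-in-trunk in-trunk in
    trans (KST≡ (walk-T-trunk W)) (sym (cong₂ _,_ (T≡ W) (cong₂ _,_ (S≡ W) (Walk.last W))))

  relabel-T-branch : ∀ {w} → InBranch B w →
    (K B (act B w T) , Sᵢ B (act B w T) , Tᵢ B (act B w T)) ≡ (Tᵢ B w , K B w , Sᵢ B w)
  relabel-T-branch in-branch = let (_ , _ , _ , _ , W) = walk-in-branch in-branch in
    trans (KST≡ (walk-T-branch W)) (sym (cong₂ _,_ (T≡ W) (cong₂ _,_ (Walk.last W) (S≡ W))))

opaque
  lemma6p4 : (R : RealNumbers) → let open Cluster R in
      (B : Mat) → SkewSymmetrizable B → ClusterCyclic B →
      (w : Seq) → Reduced w → ¬ (w ≡ []) →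
        ((InTrunk B w ⇔ (¬ (ε B w (Tᵢ B w) ≡ ε B w (K B w))))
        × ((¬ (ε B w (Tᵢ B w) ≡ ε B w (K B w)))
            ⇔ ((ε B w (Tᵢ B w) · sign (Bw B w (K B w) (Tᵢ B w))) ≡ pos))
        × (InBranch B w ⇔ (ε B w (Tᵢ B w) ≡ ε B w (K B w)))
        × ((ε B w (Tᵢ B w) ≡ ε B w (K B w))
            ⇔ ((ε B w (Tᵢ B w) · sign (Bw B w (K B w) (Tᵢ B w))) ≡ neg))
        × (¬ (ε B w (K B w) ≡ ε B w (Sᵢ B w))))
        × ((K B (act B w S) , Sᵢ B (act B w S) , Tᵢ B (act B w S))
              ≡ (Sᵢ B w , K B w , Tᵢ B w))
        × (InTrunk B w → (K B (act B w T) , Sᵢ B (act B w T) , Tᵢ B (act B w T))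
              ≡ (Tᵢ B w , Sᵢ B w , K B w))
        × (InBranch B w → (K B (act B w T) , Sᵢ B (act B w T) , Tᵢ B (act B w T))
              ≡ (Tᵢ B w , K B w , Sᵢ B w))
  lemma6p4 R B _ cc w r w≢[] =
    ( trunk⇔εT≢εK r w≢[] , εT≢εK⇔sign-pos r w≢[] , branch⇔εT≡εK r w≢[]
    , εT≡εK⇔sign-neg r w≢[] , εK≢εS r w≢[] )
    , relabel-S r w≢[] , relabel-T-trunk , relabel-T-branch
    where open Walks R B cc
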